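{- For every non-negative integer $n$, $$\sum_{m\ge 0}\binom{m}{2}a_2(m,n)\ge\sum_{m\ge 0}\binom{m}{2}b_2(m,n).$$
   Context: A partition of $n$ is a non-increasing finite sequence of positive integers summing to $n$ (the empty partition is the unique partition of $0$). Its Young diagram has $\lambda_i$ left-justified cells in row $i$; with $\lambda'_j$ the number of cells in column $j$, the hook length of cell $(i,j)$ is $h(i,j)=\lambda_i+\lambda'_j-i-j+1$. $a_2(m,n)$ is the number of partitions of $n$ into odd parts whose Young diagram has exactly $m$ cells of hook length $2$; $b_2(m,n)$ is the number of partitions of $n$ into distinct parts whose Young diagram has exactly $m$ cells of hook length $2$. -}

module Defs where

open import Data.Nat using (ℕ; zero; suc; _+_; _∸_; _≤_; _<_; _≥_; _≟_; _≤?_; _<?_; _%_)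
open import Data.Nat.Combinatorics using (_C_)
open import Data.Nat.ListAction using (sum)
open import Data.List using (List; []; _∷_; length; map; filter; concatMap; upTo; lookup)
open import Data.List.Relation.Unary.All using (All; all?)
open import Data.List.Relation.Unary.Linked using (Linked; linked?)
open import Data.List.Relation.Unary.Unique.Propositional using (Unique)
open import Data.List.Relation.Unary.Unique.DecPropositional _≟_ using (unique?)
open import Data.Product using (_×_)
open import Relation.Binary.PropositionalEquality using (_≡_)
open import Relation.Nullary using (Dec)
open import Relation.Nullary.Decidable using (_×-dec_)

IsPartitionOf : ℕ → List ℕ → Set
IsPartitionOf n λs = All (0 <_) λs × Linked _≥_ λs × sum λs ≡ n

isPartitionOf? : (n : ℕ) (λs : List ℕ) → Dec (IsPartitionOf n λs)
isPartitionOf? n λs = all? (0 <?_) λs ×-dec (linked? (λ x y → y ≤? x) λs ×-dec (sum λs ≟ n))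

Odd : ℕ → Set
Odd k = k % 2 ≡ 1

AllOdd : List ℕ → Set
AllOdd = All Odd

allOdd? : (λs : List ℕ) → Dec (AllOdd λs)
allOdd? = all? (λ k → k % 2 ≟ 1)

Distinct : List ℕ → Set
Distinct = Unique

distinct? : (λs : List ℕ) → Dec (Distinct λs)
distinct? = unique?

-- Young diagram data (1-indexed rows i and columns j).
-- row length λ_i (0 outside the diagram)
rowLen : List ℕ → ℕ → ℕ
rowLen []       _             = 0
rowLen (x ∷ xs) zero          = 0
rowLen (x ∷ xs) (suc zero)    = x
rowLen (x ∷ xs) (suc (suc i)) = rowLen xs (suc i)

colLen : List ℕ → ℕ → ℕ
colLen λs j = length (filter (λ x → j ≤? x) λs)

-- hook length of cell (i,j), for cells in the diagram (1 ≤ j ≤ λ_i, 1 ≤ i ≤ λ'_j):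
-- h(i,j) = λ_i + λ'_j - i - j + 1, written without truncation issues
hook : List ℕ → ℕ → ℕ → ℕ
hook λs i j = (rowLen λs i ∸ j) + (colLen λs j ∸ i) + 1

cells : List ℕ → List (ℕ × ℕ)
cells λs = concatMap (λ i → map (λ j → (suc i , suc j)) (upTo (rowLen λs (suc i)))) (upTo (length λs))
  where open Data.Product using (_,_)

hooks2 : List ℕ → ℕ
hooks2 λs = length (filter (λ c → hook λs (proj₁ c) (proj₂ c) ≟ 2) (cells λs))
  where open Data.Product using (proj₁; proj₂)

listsOfLen : ℕ → ℕ → List (List ℕ)
listsOfLen zero    b = [] ∷ []
listsOfLen (suc k) b = concatMap (λ x → map (suc x ∷_) (listsOfLen k b)) (upTo b)

-- A finite search space containing every partition of n
-- (at most n parts, each part at most n).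
candidates : ℕ → List (List ℕ)
candidates n = concatMap (λ k → listsOfLen k n) (upTo (suc n))

partitions : ℕ → List (List ℕ)
partitions n = filter (isPartitionOf? n) (candidates n)

a₂ : ℕ → ℕ → ℕ
a₂ m n = length (filter (λ λs → allOdd? λs ×-dec (hooks2 λs ≟ m)) (partitions n))

b₂ : ℕ → ℕ → ℕ
b₂ m n = length (filter (λ λs → distinct? λs ×-dec (hooks2 λs ≟ m)) (partitions n))

-- Σ_{m ≥ 0} C(m,2) f(m,n).  A partition of n has n cells, so a₂(m,n) = b₂(m,n) = 0
-- for m > n; the sum over m ≥ 0 is therefore the finite sum over 0 ≤ m ≤ n.
weightedSum : (ℕ → ℕ → ℕ) → ℕ → ℕ
weightedSum f n = sum (map (λ m → (m C 2) Data.Nat.* f m n) (upTo (suc n)))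

-- Both sums count pairs of cells of hook length 2, and the inequality comes from an injection between such pairs.
--
-- If λ has distinct parts, w = λ − (ℓ, …, 2, 1) is a partition with zero parts allowed, and the cells of hook
-- length 2 of λ correspond to the distinct nonzero parts of w; so the sum over distinct partitions counts triples
-- (λ, g₁, g₂) with g₁ > g₂ distinct nonzero parts of w.  If μ has odd parts, distinct parts differ by at least 2,
-- so the last row of each part size a ≥ 3 contains a cell of hook length 2, and so does the row above it when a is
-- repeated; hence parts b ≥ a ≥ 3 of μ, with b = a only for a repeated part, name a pair of such cells.
--
-- Given (λ, g₁, g₂), put y = g₂ − 1 and x = g₁ − g₂ − 1, delete g₁ and g₂ from w, add the staircase back, raise
-- every part by 2, and append a part 2 if y is odd and a part 1 if x is odd.  The result has distinct parts;
-- Glaisher's map turns it into odd parts, and adding the parts a = 3 + 2⌊y/2⌋ and b = a + 2⌊x/2⌋ restores the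
-- weight |λ|.  Since Glaisher's map is injective, the resulting odd partition with (b, a) determines x, y and the
-- remaining parts of w, hence (λ, g₁, g₂).

module Submission where

open import Defs

open import Data.Bool.Base using (true; false; if_then_else_)
open import Data.Empty using (⊥-elim)
open import Data.List using (List; []; _∷_; _++_; [_]; _∷ʳ_; length; map; filter; concatMap; replicate; upTo; applyUpTo)
open import Data.List.Properties using (length-++; length-map; length-replicate; map-∘; map-injective; ∷-injective; map-upTo; upTo-∷ʳ; concatMap-map; concatMap-cong; map-concatMap; filter-++; filter-none; filter-some)
open import Data.List.Membership.Propositional using (_∈_)
open import Data.List.Membership.Propositional.Properties using (∈-map⁺; ∈-map⁻; ∈-++⁺ˡ; ∈-++⁺ʳ; ∈-++⁻; ∈-∃++; ∈-concatMap⁺; ∈-concatMap⁻; ∈-upTo⁺; ∈-upTo⁻; ∈-filter⁺; ∈-filter⁻)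
open import Data.List.Relation.Binary.Permutation.Propositional using (_↭_; ↭-refl; ↭-reflexive; ↭-prep; ↭-swap; ↭-sym; ↭-trans; ↭⇒↭ₛ)
open import Data.List.Relation.Binary.Permutation.Propositional.Properties using (↭-length; ∈-resp-↭; All-resp-↭; shift; filter-↭; drop-∷)
open import Data.List.Relation.Binary.Pointwise using (Pointwise-≡⇒≡)
open import Data.List.Relation.Binary.Subset.Propositional using (_⊆_)
open import Data.List.Relation.Unary.All as All using (All; []; _∷_)
import Data.List.Relation.Unary.All.Properties as Allₚ
open import Data.List.Relation.Unary.AllPairs as AllPairs using (AllPairs; []; _∷_)
import Data.List.Relation.Unary.AllPairs.Properties as AllPairsₚ
import Data.List.Relation.Unary.Any as Any
open import Data.List.Relation.Unary.Any using (here; there)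
open import Data.List.Relation.Unary.Linked as Linked using (Linked; []; [-]; _∷_)
open import Data.List.Relation.Unary.Linked.Properties as Linkedₚ using (Linked⇒All)
open import Data.List.Relation.Unary.Sorted.TotalOrder.Properties using (↗↭↗⇒≋)
open import Data.List.Relation.Unary.Unique.Propositional using (Unique)
import Data.List.Relation.Unary.Unique.Propositional.Properties as Uniqueₚ
import Data.List.Sort as Sort
open import Data.Nat using (ℕ; zero; suc; _+_; _*_; _∸_; _⊓_; _^_; _≤_; _<_; _≥_; _>_; _≟_; _≤?_; _<?_; z≤n; s≤s)
open import Data.Nat.Combinatorics using (_C_; nC1≡n; nCk+nC[k+1]≡[n+1]C[k+1])
open import Data.Nat.DivMod using (_%_; _/_; m≡m%n+[m/n]*n; m%n<n; m/n≤m; [m+kn]%n≡m%n; %-distribˡ-+)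
open import Data.Nat.ListAction using (sum)
open import Data.Nat.ListAction.Properties using (sum-++; sum-↭)
open import Data.Nat.Properties
open import Data.Nat.Solver using (module +-*-Solver)
open import Data.Product using (_×_; _,_; proj₁; proj₂; ∃₂; uncurry; map₁)
open import Data.Sum using (inj₁; inj₂)
open import Function using (_∘_; _⇔_; mk⇔; Equivalence)
open import Level using (0ℓ)
open import Relation.Binary.Bundles using (DecTotalOrder)
import Relation.Binary.Construct.Flip.EqAndOrd as Flip
open import Relation.Binary.Definitions using (tri<; tri≈; tri>)
open import Relation.Binary.PropositionalEquality using (_≡_; refl; sym; trans; cong; cong₂; subst; subst₂; module ≡-Reasoning)
open import Relation.Nullary using (Dec; yes; no; ¬_; does)
open import Relation.Nullary.Decidable using (_×-dec_)
open import Relation.Unary using (Pred; Decidable)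

open +-*-Solver using (solve; _:+_; _:*_; con; _:=_)
open import Algebra.Properties.CommutativeSemigroup +-commutativeSemigroup using (interchange)

-- Defined through does, so that 𝟙 (suc m ≟ suc n) and 𝟙 (m ≟ n) are definitionally equal.
𝟙 : ∀ {p} {P : Set p} → Dec P → ℕ
𝟙 d = if does d then 1 else 0

𝟙-yes : ∀ {p} {P : Set p} (d : Dec P) → P → 𝟙 d ≡ 1
𝟙-yes (yes _) _ = refl
𝟙-yes (no ¬p) p = ⊥-elim (¬p p)

𝟙-no : ∀ {p} {P : Set p} (d : Dec P) → ¬ P → 𝟙 d ≡ 0
𝟙-no (yes p) ¬p = ⊥-elim (¬p p)
𝟙-no (no _)  _  = refl

𝟙-cong : ∀ {p q} {P : Set p} {Q : Set q} (d : Dec P) (e : Dec Q) → (P → Q) → (Q → P) → 𝟙 d ≡ 𝟙 e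
𝟙-cong (yes p) e f g = sym (𝟙-yes e (f p))
𝟙-cong (no ¬p) e f g = sym (𝟙-no e (¬p ∘ g))

𝟙≤1 : ∀ {p} {P : Set p} (d : Dec P) → 𝟙 d ≤ 1
𝟙≤1 (yes _) = ≤-refl
𝟙≤1 (no _)  = z≤n

length-filter-∷ : ∀ {A : Set} {p} {P : Pred A p} (P? : Decidable P) x xs →
                  length (filter P? (x ∷ xs)) ≡ 𝟙 (P? x) + length (filter P? xs)
length-filter-∷ P? x xs with does (P? x)
... | true  = refl
... | false = refl

length-filter-++ : ∀ {A : Set} {p} {P : Pred A p} (P? : Decidable P) xs ys →
                   length (filter P? (xs ++ ys)) ≡ length (filter P? xs) + length (filter P? ys)
length-filter-++ P? xs ys = trans (cong length (filter-++ P? xs ys)) (length-++ (filter P? xs))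

length-filter-∷ʳ : ∀ {A : Set} {p} {P : Pred A p} (P? : Decidable P) xs x →
                   length (filter P? (xs ∷ʳ x)) ≡ length (filter P? xs) + 𝟙 (P? x)
length-filter-∷ʳ P? xs x = trans (length-filter-++ P? xs [ x ])
                                 (cong (length (filter P? xs) +_) (trans (length-filter-∷ P? x []) (+-identityʳ (𝟙 (P? x)))))


length-filter-map : ∀ {A B : Set} {p} {P : Pred B p} (P? : Decidable P) (f : A → B) xs →
                    length (filter P? (map f xs)) ≡ length (filter (P? ∘ f) xs)
length-filter-map P? f []       = refl
length-filter-map P? f (x ∷ xs) with does (P? (f x))
... | true  = cong suc (length-filter-map P? f xs)
... | false = length-filter-map P? f xs

length-filter-cong : ∀ {A : Set} {p q} {P : Pred A p} {Q : Pred A q} (P? : Decidable P) (Q? : Decidable Q) xs →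
                     (∀ {x} → x ∈ xs → P x → Q x) → (∀ {x} → x ∈ xs → Q x → P x) →
                     length (filter P? xs) ≡ length (filter Q? xs)
length-filter-cong P? Q? []       _   _   = refl
length-filter-cong P? Q? (x ∷ xs) P⇒Q Q⇒P = begin
  length (filter P? (x ∷ xs))              ≡⟨ length-filter-∷ P? x xs ⟩
  𝟙 (P? x) + length (filter P? xs)         ≡⟨ cong₂ _+_ (𝟙-cong (P? x) (Q? x) (P⇒Q (here refl)) (Q⇒P (here refl)))
                                                         (length-filter-cong P? Q? xs (P⇒Q ∘ there) (Q⇒P ∘ there)) ⟩
  𝟙 (Q? x) + length (filter Q? xs)         ≡⟨ length-filter-∷ Q? x xs ⟨
  length (filter Q? (x ∷ xs))              ∎
  where open ≡-Reasoning

count : ℕ → List ℕ → ℕ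
count a = length ∘ filter (a ≟_)

count-∷ : ∀ a x xs → count a (x ∷ xs) ≡ 𝟙 (a ≟ x) + count a xs
count-∷ a = length-filter-∷ (a ≟_)

count-self : ∀ a xs → count a (a ∷ xs) ≡ suc (count a xs)
count-self a xs = trans (count-∷ a a xs) (cong (_+ count a xs) (𝟙-yes (a ≟ a) refl))

count-++ : ∀ a xs ys → count a (xs ++ ys) ≡ count a xs + count a ys
count-++ a = length-filter-++ (a ≟_)

count-replicate : ∀ a n b → count a (replicate n b) ≡ 𝟙 (a ≟ b) * n
count-replicate a zero    b = sym (*-zeroʳ (𝟙 (a ≟ b)))
count-replicate a (suc n) b = trans (length-filter-∷ (a ≟_) b (replicate n b))
                                    (trans (cong (𝟙 (a ≟ b) +_) (count-replicate a n b)) (sym (*-suc (𝟙 (a ≟ b)) n)))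

count-↭ : ∀ a {xs ys} → xs ↭ ys → count a xs ≡ count a ys
count-↭ a xs↭ys = ↭-length (filter-↭ (a ≟_) xs↭ys)

count>0⇒∈ : ∀ {a} xs → 0 < count a xs → a ∈ xs
count>0⇒∈ {a} xs 0<count with filter (a ≟_) xs in eq
... | y ∷ _ with ∈-filter⁻ (a ≟_) {xs = xs} (subst (y ∈_) (sym eq) (here refl))
...   | y∈xs , refl = y∈xs

∈⇒count>0 : ∀ {a xs} → a ∈ xs → 0 < count a xs
∈⇒count>0 {a} = filter-some (a ≟_)

sum-map-+ : ∀ {A : Set} (f g : A → ℕ) xs → sum (map (λ x → f x + g x) xs) ≡ sum (map f xs) + sum (map g xs)
sum-map-+ f g []       = refl
sum-map-+ f g (x ∷ xs) = begin
  f x + g x + sum (map (λ x → f x + g x) xs)        ≡⟨ cong (f x + g x +_) (sum-map-+ f g xs) ⟩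
  f x + g x + (sum (map f xs) + sum (map g xs))     ≡⟨ interchange (f x) (g x) (sum (map f xs)) (sum (map g xs)) ⟩
  f x + sum (map f xs) + (g x + sum (map g xs))     ∎
  where open ≡-Reasoning

sum-map-cong : ∀ {A : Set} (f g : A → ℕ) xs → (∀ {x} → x ∈ xs → f x ≡ g x) → sum (map f xs) ≡ sum (map g xs)
sum-map-cong f g []       _   = refl
sum-map-cong f g (x ∷ xs) f≡g = cong₂ _+_ (f≡g (here refl)) (sum-map-cong f g xs (f≡g ∘ there))

sum-map-0 : ∀ {A : Set} (f : A → ℕ) xs → (∀ x → f x ≡ 0) → sum (map f xs) ≡ 0
sum-map-0 f []       _   = refl
sum-map-0 f (x ∷ xs) f≡0 = cong₂ _+_ (f≡0 x) (sum-map-0 f xs f≡0)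

sum-replicate : ∀ n x → sum (replicate n x) ≡ n * x
sum-replicate zero    x = refl
sum-replicate (suc n) x = cong (x +_) (sum-replicate n x)

sum-map-2+ : ∀ xs → sum (map (2 +_) xs) ≡ sum xs + 2 * length xs
sum-map-2+ []       = refl
sum-map-2+ (x ∷ xs) rewrite sum-map-2+ xs =
  solve 3 (λ x s ℓ → con 2 :+ x :+ (s :+ con 2 :* ℓ) := x :+ s :+ con 2 :* (con 1 :+ ℓ)) refl x (sum xs) (length xs)

sum-upTo-suc : ∀ (f : ℕ → ℕ) N → sum (map f (upTo (suc N))) ≡ f 0 + sum (map (f ∘ suc) (upTo N))
sum-upTo-suc f N = cong (λ ms → f 0 + sum ms) (trans (cong (map f) (sym (map-upTo suc N))) (sym (map-∘ (upTo N))))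

sum-upTo-𝟙 : ∀ (g : ℕ → ℕ) v N → sum (map (λ m → g m * 𝟙 (v ≟ m)) (upTo N)) ≡ 𝟙 (v <? N) * g v
sum-upTo-𝟙 g v       zero    = refl
sum-upTo-𝟙 g zero    (suc N) = begin
  sum (map (λ m → g m * 𝟙 (0 ≟ m)) (upTo (suc N)))
    ≡⟨ sum-upTo-suc _ N ⟩
  g 0 * 1 + sum (map (λ m → g (suc m) * 0) (upTo N))
    ≡⟨ cong₂ _+_ (*-identityʳ (g 0)) (sum-map-0 _ (upTo N) (*-zeroʳ ∘ g ∘ suc)) ⟩
  g 0 + 0
    ∎
  where open ≡-Reasoning
sum-upTo-𝟙 g (suc v) (suc N) = begin
  sum (map (λ m → g m * 𝟙 (suc v ≟ m)) (upTo (suc N)))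
    ≡⟨ sum-upTo-suc _ N ⟩
  g 0 * 0 + sum (map (λ m → g (suc m) * 𝟙 (v ≟ m)) (upTo N))
    ≡⟨ cong (_+ sum (map (λ m → g (suc m) * 𝟙 (v ≟ m)) (upTo N))) (*-zeroʳ (g 0)) ⟩
  sum (map (λ m → g (suc m) * 𝟙 (v ≟ m)) (upTo N))
    ≡⟨ sum-upTo-𝟙 (g ∘ suc) v N ⟩
  𝟙 (v <? N) * g (suc v)
    ∎
  where open ≡-Reasoning

sum-fibres : ∀ {A : Set} {q} {Q : Pred A q} (Q? : Decidable Q) (h : A → ℕ) (g : ℕ → ℕ) N xs →
             All (λ x → h x < N) xs →
             sum (map (λ m → g m * length (filter (λ x → Q? x ×-dec (h x ≟ m)) xs)) (upTo N))
             ≡ sum (map (g ∘ h) (filter Q? xs))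
sum-fibres Q? h g N []       _           = sum-map-0 _ (upTo N) (*-zeroʳ ∘ g)
sum-fibres {A} Q? h g N (x ∷ xs) (hx<N ∷ h<N) = begin
  sum (map (λ m → g m * fibre (x ∷ xs) m) (upTo N))
    ≡⟨ sum-map-cong _ _ (upTo N) (λ {m} _ → trans (cong (g m *_) (length-filter-∷ _ x xs)) (*-distribˡ-+ (g m) _ _)) ⟩
  sum (map (λ m → g m * 𝟙 (Q? x ×-dec (h x ≟ m)) + g m * fibre xs m) (upTo N))
    ≡⟨ sum-map-+ _ _ (upTo N) ⟩
  sum (map (λ m → g m * 𝟙 (Q? x ×-dec (h x ≟ m))) (upTo N)) + sum (map (λ m → g m * fibre xs m) (upTo N))
    ≡⟨ cong₂ _+_ head-term (sum-fibres Q? h g N xs h<N) ⟩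
  𝟙 (Q? x) * g (h x) + sum (map (g ∘ h) (filter Q? xs))
    ≡⟨ filter-step ⟩
  sum (map (g ∘ h) (filter Q? (x ∷ xs)))
    ∎
  where
  open ≡-Reasoning
  fibre : List A → ℕ → ℕ
  fibre ys m = length (filter (λ y → Q? y ×-dec (h y ≟ m)) ys)
  head-term : sum (map (λ m → g m * 𝟙 (Q? x ×-dec (h x ≟ m))) (upTo N)) ≡ 𝟙 (Q? x) * g (h x)
  head-term with Q? x
  ... | yes _ = trans (sum-upTo-𝟙 g (h x) N) (cong (_* g (h x)) (𝟙-yes (h x <? N) hx<N))
  ... | no  _ = sum-map-0 _ (upTo N) (*-zeroʳ ∘ g)
  filter-step : 𝟙 (Q? x) * g (h x) + sum (map (g ∘ h) (filter Q? xs)) ≡ sum (map (g ∘ h) (filter Q? (x ∷ xs)))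
  filter-step with Q? x
  ... | yes _ = cong (_+ sum (map (g ∘ h) (filter Q? xs))) (+-identityʳ (g (h x)))
  ... | no  _ = refl

Unique-concatMap : ∀ {A B : Set} (F : A → List B) {xs} → Unique xs → (∀ {x} → x ∈ xs → Unique (F x)) →
                   (∀ {x y z} → z ∈ F x → z ∈ F y → x ≡ y) → Unique (concatMap F xs)
Unique-concatMap F xs! F! F-disjoint =
  Uniqueₚ.concat⁺ (Allₚ.map⁺ (All.tabulate F!))
                 (AllPairsₚ.map⁺ (AllPairs.map (λ x≢y {_} (z∈Fx , z∈Fy) → x≢y (F-disjoint z∈Fx z∈Fy)) xs!))

Unique-map-injectiveOn : ∀ {A B : Set} (f : A → B) {xs} → (∀ {x y} → x ∈ xs → y ∈ xs → f x ≡ f y → x ≡ y) →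
                         Unique xs → Unique (map f xs)
Unique-map-injectiveOn f {[]}     _   []           = []
Unique-map-injectiveOn f {x ∷ xs} inj (x∉xs ∷ xs!) =
  Allₚ.map⁺ (All.tabulate (λ y∈xs fx≡fy → All.lookup x∉xs y∈xs (inj (here refl) (there y∈xs) fx≡fy)))
  ∷ Unique-map-injectiveOn f (λ x∈ y∈ → inj (there x∈) (there y∈)) xs!

Unique-⊆⇒length-≤ : ∀ {A : Set} {xs ys : List A} → Unique xs → xs ⊆ ys → length xs ≤ length ys
Unique-⊆⇒length-≤ {xs = []}     _            _     = z≤n
Unique-⊆⇒length-≤ {xs = x ∷ xs} (x∉xs ∷ xs!) xs⊆ys with ys₁ , ys₂ , refl ← ∈-∃++ (xs⊆ys (here refl)) =
  subst (suc (length xs) ≤_) (sym (↭-length (shift x ys₁ ys₂))) (s≤s (Unique-⊆⇒length-≤ xs! xs⊆ys₁++ys₂))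
  where
  xs⊆ys₁++ys₂ : xs ⊆ ys₁ ++ ys₂
  xs⊆ys₁++ys₂ z∈xs with ∈-resp-↭ (shift x ys₁ ys₂) (xs⊆ys (there z∈xs))
  ... | here z≡x = ⊥-elim (All.lookup x∉xs z∈xs (sym z≡x))
  ... | there z∈ = z∈

tagged : ∀ {A B : Set} → (A → List B) → List A → List (A × B)
tagged F = concatMap (λ a → map (a ,_) (F a))

length-tagged : ∀ {A B : Set} (F : A → List B) xs → length (tagged F xs) ≡ sum (map (length ∘ F) xs)
length-tagged F []       = refl
length-tagged F (a ∷ xs) = begin
  length (map (a ,_) (F a) ++ tagged F xs)      ≡⟨ length-++ (map (a ,_) (F a)) ⟩
  length (map (a ,_) (F a)) + length (tagged F xs) ≡⟨ cong₂ _+_ (length-map (a ,_) (F a)) (length-tagged F xs) ⟩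
  length (F a) + sum (map (length ∘ F) xs)      ∎
  where open ≡-Reasoning

∈-tagged⁺ : ∀ {A B : Set} (F : A → List B) {xs a b} → a ∈ xs → b ∈ F a → (a , b) ∈ tagged F xs
∈-tagged⁺ F {a = a} a∈xs b∈Fa = ∈-concatMap⁺ (λ x → map (x ,_) (F x)) (Any.map (λ { refl → ∈-map⁺ (a ,_) b∈Fa }) a∈xs)

∈-tagged⁻ : ∀ {A B : Set} (F : A → List B) xs {a b} → (a , b) ∈ tagged F xs → a ∈ xs × b ∈ F a
∈-tagged⁻ F (x ∷ xs) ab∈ with ∈-++⁻ (map (x ,_) (F x)) ab∈
... | inj₁ ab∈map with ∈-map⁻ (x ,_) ab∈map
...   | _ , b∈Fx , refl = here refl , b∈Fx
∈-tagged⁻ F (x ∷ xs) ab∈ | inj₂ ab∈rest = map₁ there (∈-tagged⁻ F xs ab∈rest)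

Unique-tagged : ∀ {A B : Set} (F : A → List B) {xs} → Unique xs → (∀ {a} → a ∈ xs → Unique (F a)) → Unique (tagged F xs)
Unique-tagged F xs! F! = Unique-concatMap _ xs! (λ {a} a∈ → Uniqueₚ.map⁺ (λ { refl → refl }) (F! a∈)) same-tag
  where
  same-tag : ∀ {x y z} → z ∈ map (x ,_) (F x) → z ∈ map (y ,_) (F y) → x ≡ y
  same-tag z∈x z∈y with ∈-map⁻ _ z∈x | ∈-map⁻ _ z∈y
  ... | _ , _ , refl | _ , _ , refl = refl

pairsOf : ∀ {A : Set} → List A → List (A × A)
pairsOf []       = []
pairsOf (a ∷ as) = map (a ,_) as ++ pairsOf as

length-pairsOf : ∀ {A : Set} (xs : List A) → length (pairsOf xs) ≡ length xs C 2
length-pairsOf []       = refl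
length-pairsOf (a ∷ as) = begin
  length (map (a ,_) as ++ pairsOf as)
    ≡⟨ length-++ (map (a ,_) as) ⟩
  length (map (a ,_) as) + length (pairsOf as)
    ≡⟨ cong₂ _+_ (trans (length-map (a ,_) as) (sym (nC1≡n (length as)))) (length-pairsOf as) ⟩
  length as C 1 + length as C 2
    ≡⟨ nCk+nC[k+1]≡[n+1]C[k+1] (length as) 1 ⟩
  suc (length as) C 2
    ∎
  where open ≡-Reasoning

∈-pairsOf⁻ : ∀ {A : Set} {xs : List A} {a b} → (a , b) ∈ pairsOf xs → a ∈ xs × b ∈ xs
∈-pairsOf⁻ {xs = c ∷ cs} ab∈ with ∈-++⁻ (map (c ,_) cs) ab∈
... | inj₁ ab∈map with ∈-map⁻ (c ,_) ab∈map
...   | _ , b∈cs , refl = here refl , there b∈cs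
∈-pairsOf⁻ {xs = c ∷ cs} ab∈ | inj₂ ab∈rest with ∈-pairsOf⁻ ab∈rest
... | a∈cs , b∈cs = there a∈cs , there b∈cs

AllPairs⇒All-pairsOf : ∀ {A : Set} {r} {R : A → A → Set r} {xs} → AllPairs R xs → All (uncurry R) (pairsOf xs)
AllPairs⇒All-pairsOf {xs = []}     []          = []
AllPairs⇒All-pairsOf {xs = c ∷ cs} (Rc ∷ Rcs) = Allₚ.++⁺ (Allₚ.map⁺ Rc) (AllPairs⇒All-pairsOf Rcs)

Unique-pairsOf : ∀ {A : Set} {xs : List A} → Unique xs → Unique (pairsOf xs)
Unique-pairsOf {xs = []}     []           = []
Unique-pairsOf {xs = a ∷ as} (a∉as ∷ as!) =
  Uniqueₚ.++⁺ (Uniqueₚ.map⁺ (λ { refl → refl }) as!) (Unique-pairsOf as!) first-differs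
  where
  first-differs : ∀ {v} → ¬ (v ∈ map (a ,_) as × v ∈ pairsOf as)
  first-differs (v∈map , v∈rest) with ∈-map⁻ (a ,_) v∈map
  ... | _ , _ , refl = All.lookup a∉as (proj₁ (∈-pairsOf⁻ v∈rest)) refl

∈-pairsOf-< : ∀ {xs a b} → AllPairs _≥_ xs → b < a → a ∈ xs → b ∈ xs → (a , b) ∈ pairsOf xs
∈-pairsOf-< {c ∷ cs} _          b<a (here refl) (here refl) = ⊥-elim (<-irrefl refl b<a)
∈-pairsOf-< {c ∷ cs} _          b<a (here refl) (there b∈)  = ∈-++⁺ˡ (∈-map⁺ (c ,_) b∈)
∈-pairsOf-< {c ∷ cs} (c≥ ∷ _)   b<a (there a∈)  (here refl) = ⊥-elim (<⇒≱ b<a (All.lookup c≥ a∈))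
∈-pairsOf-< {c ∷ cs} (_ ∷ cs≥)  b<a (there a∈)  (there b∈)  = ∈-++⁺ʳ (map (c ,_) cs) (∈-pairsOf-< cs≥ b<a a∈ b∈)

∈-pairsOf-≡ : ∀ {a} xs → 2 ≤ count a xs → (a , a) ∈ pairsOf xs
∈-pairsOf-≡ {a} (c ∷ cs) 2≤count = split (a ≟ c) (subst (2 ≤_) (length-filter-∷ (a ≟_) c cs) 2≤count)
  where
  split : (a≟c : Dec (a ≡ c)) → 2 ≤ 𝟙 a≟c + count a cs → (a , a) ∈ pairsOf (c ∷ cs)
  split (yes refl) 1≤count = ∈-++⁺ˡ (∈-map⁺ (a ,_) (count>0⇒∈ cs (≤-pred 1≤count)))
  split (no  _)    2≤count = ∈-++⁺ʳ (map (c ,_) cs) (∈-pairsOf-≡ cs 2≤count)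

≥-trans : ∀ {i j k : ℕ} → i ≥ j → j ≥ k → i ≥ k
≥-trans i≥j j≥k = ≤-trans j≥k i≥j

head-≥ : ∀ {x xs} → Linked _≥_ (x ∷ xs) → All (_≤ x) xs
head-≥ [-]         = []
head-≥ (x≥y ∷ y∷ys) = Linked⇒All ≥-trans x≥y y∷ys

head-> : ∀ {x xs} → Linked _>_ (x ∷ xs) → All (_< x) xs
head-> [-]           = []
head-> (y<x ∷ y∷ys>) = Linked⇒All (λ j<i k<j → <-trans k<j j<i) y<x y∷ys>

All-<-∷ : ∀ {x xs m} → Linked _>_ (x ∷ xs) → x < m → All (_< m) (x ∷ xs)
All-<-∷ x∷xs> x<m = x<m ∷ All.map (λ y<x → <-trans y<x x<m) (head-> x∷xs>)

Linked-tail : ∀ {r} {R : ℕ → ℕ → Set r} {x xs} → Linked R (x ∷ xs) → Linked R xs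
Linked-tail [-]      = []
Linked-tail (_ ∷ xs) = xs

Linked-≥-∷ : ∀ {a xs} → All (_≤ a) xs → Linked _≥_ xs → Linked _≥_ (a ∷ xs)
Linked-≥-∷ []        _  = [-]
Linked-≥-∷ (y≤a ∷ _) xs≥ = y≤a ∷ xs≥

Linked->-++ : ∀ {c xs ys} → Linked _>_ xs → All (c <_) xs → Linked _>_ ys → All (_≤ c) ys → Linked _>_ (xs ++ ys)
Linked->-++ []              _             ys> _          = ys>
Linked->-++ {ys = []}     [-] _             _   _          = [-]
Linked->-++ {ys = y ∷ _}  [-] (c<x ∷ _)     ys> (y≤c ∷ _)  = ≤-<-trans y≤c c<x ∷ ys>
Linked->-++ (x′<x ∷ x′∷xs>) (_ ∷ c<xs) ys> ys≤c = x′<x ∷ Linked->-++ x′∷xs> c<xs ys> ys≤c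

Linked-≥∧Unique⇒Linked-> : ∀ {xs} → Linked _≥_ xs → Unique xs → Linked _>_ xs
Linked-≥∧Unique⇒Linked-> []                _                  = []
Linked-≥∧Unique⇒Linked-> [-]               _                  = [-]
Linked-≥∧Unique⇒Linked-> (y≤x ∷ y∷ys≥) ((x≢y ∷ _) ∷ y∷ys!) =
  ≤∧≢⇒< y≤x (x≢y ∘ sym) ∷ Linked-≥∧Unique⇒Linked-> y∷ys≥ y∷ys!

AllPairs->⇒Unique : ∀ {xs} → AllPairs _>_ xs → Unique xs
AllPairs->⇒Unique = AllPairs.map (λ y<x x≡y → <-irrefl (sym x≡y) y<x)

AllPairs-replicate : ∀ {A : Set} {r} {R : A → A → Set r} n {x} → R x x → AllPairs R (replicate n x)
AllPairs-replicate zero    _   = []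
AllPairs-replicate (suc n) Rxx = Allₚ.replicate⁺ n Rxx ∷ AllPairs-replicate n Rxx

∈⇒≤head : ∀ {v ws} → Linked _≥_ ws → v ∈ ws → v ≤ rowLen ws 1
∈⇒≤head _     (here refl) = ≤-refl
∈⇒≤head w∷ws≥ (there v∈)  = All.lookup (head-≥ w∷ws≥) v∈

++-split : ∀ {c xs xs′ ys ys′} → All (c ≤_) xs → All (c ≤_) xs′ → All (_< c) ys → All (_< c) ys′ →
           xs ++ ys ≡ xs′ ++ ys′ → xs ≡ xs′ × ys ≡ ys′
++-split {xs = []}     {[]}       _ _ _ _ eq = refl , eq
++-split {xs = []}     {x′ ∷ _}   _ (c≤x′ ∷ _) ys<c _ refl = ⊥-elim (<⇒≱ (All.head ys<c) c≤x′)
++-split {xs = x ∷ _}  {[]}       (c≤x ∷ _) _ _ ys′<c refl = ⊥-elim (<⇒≱ (All.head ys′<c) c≤x)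
++-split {xs = x ∷ xs} {x′ ∷ xs′} (_ ∷ c≤xs) (_ ∷ c≤xs′) ys<c ys′<c eq with ∷-injective eq
... | refl , eq′ = map₁ (cong (x ∷_)) (++-split c≤xs c≤xs′ ys<c ys′<c eq′)

≥-decTotalOrder : DecTotalOrder 0ℓ 0ℓ 0ℓ
≥-decTotalOrder = Flip.decTotalOrder ≤-decTotalOrder

sortDesc : List ℕ → List ℕ
sortDesc = Sort.sort ≥-decTotalOrder

sortDesc-↭ : ∀ xs → sortDesc xs ↭ xs
sortDesc-↭ = Sort.sort-↭ ≥-decTotalOrder

sortDesc-sorted : ∀ xs → Linked _≥_ (sortDesc xs)
sortDesc-sorted = Sort.sort-↗ ≥-decTotalOrder

sorted-↭⇒≡ : ∀ {xs ys} → Linked _≥_ xs → Linked _≥_ ys → xs ↭ ys → xs ≡ ys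
sorted-↭⇒≡ xs≥ ys≥ xs↭ys = Pointwise-≡⇒≡ (↗↭↗⇒≋ (Flip.totalOrder ≤-totalOrder) xs≥ ys≥ (↭⇒↭ₛ xs↭ys))

remove : ℕ → List ℕ → List ℕ
remove g []       = []
remove g (a ∷ as) with g ≟ a
... | yes _ = as
... | no  _ = a ∷ remove g as

remove-↭ : ∀ {g xs} → g ∈ xs → xs ↭ g ∷ remove g xs
remove-↭ {g} {a ∷ as} g∈ with g ≟ a | g∈
... | yes refl | _          = ↭-refl
... | no  g≢a  | here g≡a   = ⊥-elim (g≢a g≡a)
... | no  _    | there g∈as = ↭-trans (↭-prep a (remove-↭ g∈as)) (↭-swap a g ↭-refl)

remove-⊆ : ∀ {g xs} → remove g xs ⊆ xs
remove-⊆ {g} {a ∷ as} v∈ with g ≟ a | v∈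
... | yes _ | v∈as       = there v∈as
... | no  _ | here refl  = here refl
... | no  _ | there v∈′ = there (remove-⊆ v∈′)

remove-sorted : ∀ {g xs} → Linked _≥_ xs → Linked _≥_ (remove g xs)
remove-sorted {g} {[]}     _      = []
remove-sorted {g} {a ∷ as} a∷as≥ with g ≟ a
... | yes _ = Linked-tail a∷as≥
... | no  _ = Linked-≥-∷ (All.tabulate (All.lookup (head-≥ a∷as≥) ∘ remove-⊆)) (remove-sorted (Linked-tail a∷as≥))

++-cancelˡ-↭ : ∀ {A : Set} (xs : List A) {ys zs} → xs ++ ys ↭ xs ++ zs → ys ↭ zs
++-cancelˡ-↭ []       ys↭zs = ys↭zs
++-cancelˡ-↭ (x ∷ xs) p     = ++-cancelˡ-↭ xs (drop-∷ p)

∈-listsOfLen⁻ : ∀ {k b xs} → xs ∈ listsOfLen k b → length xs ≡ k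
∈-listsOfLen⁻ {zero}      (here refl) = refl
∈-listsOfLen⁻ {suc k} {b} xs∈ with Any.satisfied (∈-concatMap⁻ (λ x → map (suc x ∷_) (listsOfLen k b)) {xs = upTo b} xs∈)
... | x , xs∈x with ∈-map⁻ (suc x ∷_) xs∈x
...   | ys , ys∈ , refl = cong suc (∈-listsOfLen⁻ ys∈)

∈-listsOfLen⁺ : ∀ {b} xs → All (λ a → 0 < a × a ≤ b) xs → xs ∈ listsOfLen (length xs) b
∈-listsOfLen⁺     []           _                    = here refl
∈-listsOfLen⁺ {b} (suc x ∷ xs) ((_ , x<b) ∷ xs-ok) =
  ∈-concatMap⁺ (λ y → map (suc y ∷_) (listsOfLen (length xs) b))
               (Any.map (λ { refl → ∈-map⁺ (suc x ∷_) (∈-listsOfLen⁺ xs xs-ok) }) (∈-upTo⁺ x<b))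

Unique-listsOfLen : ∀ k b → Unique (listsOfLen k b)
Unique-listsOfLen zero    b = [] ∷ []
Unique-listsOfLen (suc k) b =
  Unique-concatMap _ (Uniqueₚ.upTo⁺ b) (λ _ → Uniqueₚ.map⁺ (proj₂ ∘ ∷-injective) (Unique-listsOfLen k b)) same-head
  where
  same-head : ∀ {x y zs} → zs ∈ map (suc x ∷_) (listsOfLen k b) → zs ∈ map (suc y ∷_) (listsOfLen k b) → x ≡ y
  same-head zs∈x zs∈y with ∈-map⁻ _ zs∈x | ∈-map⁻ _ zs∈y
  ... | _ , _ , refl | _ , _ , eq = suc-injective (proj₁ (∷-injective eq))

Unique-partitions : ∀ n → Unique (partitions n)
Unique-partitions n = Uniqueₚ.filter⁺ (isPartitionOf? n)
  (Unique-concatMap _ (Uniqueₚ.upTo⁺ (suc n)) (λ {k} _ → Unique-listsOfLen k n)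
                    (λ xs∈k xs∈k′ → trans (sym (∈-listsOfLen⁻ xs∈k)) (∈-listsOfLen⁻ xs∈k′)))

∈⇒≤sum : ∀ {a} xs → a ∈ xs → a ≤ sum xs
∈⇒≤sum (x ∷ xs) (here refl) = m≤m+n x (sum xs)
∈⇒≤sum (x ∷ xs) (there a∈)  = ≤-trans (∈⇒≤sum xs a∈) (m≤n+m (sum xs) x)

length≤sum : ∀ {xs} → All (0 <_) xs → length xs ≤ sum xs
length≤sum []           = z≤n
length≤sum (0<x ∷ 0<xs) = +-mono-≤ 0<x (length≤sum 0<xs)

∈-partitions⁻ : ∀ {n xs} → xs ∈ partitions n → IsPartitionOf n xs
∈-partitions⁻ {n} {xs} xs∈ = proj₂ (∈-filter⁻ (isPartitionOf? n) {xs = candidates n} xs∈)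

∈-partitions⁺ : ∀ {n xs} → IsPartitionOf n xs → xs ∈ partitions n
∈-partitions⁺ {n} {xs} xs⊢n@(0<xs , _ , refl) = ∈-filter⁺ (isPartitionOf? n) xs∈candidates xs⊢n
  where
  xs∈candidates : xs ∈ candidates n
  xs∈candidates = ∈-concatMap⁺ (λ k → listsOfLen k n)
    (Any.map (λ { refl → ∈-listsOfLen⁺ xs (All.tabulate (λ a∈ → All.lookup 0<xs a∈ , ∈⇒≤sum xs a∈)) })
             (∈-upTo⁺ (s≤s (length≤sum 0<xs))))

-- Cells of hook length two

rowLen-≤ : ∀ {x xs} → All (_≤ x) xs → ∀ i → rowLen xs i ≤ x
rowLen-≤ []           i             = z≤n
rowLen-≤ (_ ∷ _)      zero          = z≤n
rowLen-≤ (y≤x ∷ _)    (suc zero)    = y≤x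
rowLen-≤ (_ ∷ ys≤x)   (suc (suc i)) = rowLen-≤ ys≤x (suc i)

colLen-∷ : ∀ y ys c → colLen (y ∷ ys) c ≡ 𝟙 (c ≤? y) + colLen ys c
colLen-∷ y ys c = length-filter-∷ (c ≤?_) y ys

colLen-∷-≤ : ∀ {y} ys {c} → c ≤ y → colLen (y ∷ ys) c ≡ suc (colLen ys c)
colLen-∷-≤ ys {c} c≤y = trans (colLen-∷ _ ys c) (cong (_+ colLen ys c) (𝟙-yes (c ≤? _) c≤y))

colLen≡0 : ∀ {xs c} → Linked _≥_ xs → rowLen xs 1 < c → colLen xs c ≡ 0
colLen≡0 {[]}     _     _    = refl
colLen≡0 {y ∷ ys} {c} y∷ys≥ y<c =
  cong length (filter-none (c ≤?_) (All.tabulate λ z∈ c≤z → <⇒≱ (≤-<-trans (∈⇒≤head y∷ys≥ z∈) y<c) c≤z))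

colLen≡0⇒ : ∀ xs {c} → 1 ≤ c → colLen xs c ≡ 0 → rowLen xs 1 < c
colLen≡0⇒ []       1≤c _          = 1≤c
colLen≡0⇒ (y ∷ ys) {c} _ colLen≡0 with c ≤? y
... | no  c≰y = ≰⇒> c≰y
... | yes c≤y with () ← trans (sym (colLen-∷-≤ ys c≤y)) colLen≡0

colLen≡1⇒ : ∀ {x} xs → 1 ≤ x → Linked _≥_ (x ∷ xs) → colLen xs x ≡ 1 → rowLen xs 1 ≡ x × rowLen xs 2 < x
colLen≡1⇒ {x} (y ∷ ys) 1≤x (y≤x ∷ y∷ys≥) colLen≡1 with x ≤? y
... | yes x≤y = ≤-antisym y≤x x≤y , colLen≡0⇒ ys 1≤x (suc-injective (trans (sym (colLen-∷-≤ ys x≤y)) colLen≡1))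
... | no  x≰y with () ← trans (sym (colLen≡0 y∷ys≥ (≰⇒> x≰y))) colLen≡1

colLen≡1⇐ : ∀ {x} xs → 1 ≤ x → Linked _≥_ (x ∷ xs) → rowLen xs 1 ≡ x × rowLen xs 2 < x → colLen xs x ≡ 1
colLen≡1⇐ []       1≤x _           (0≡x , _)    = ⊥-elim (<⇒≢ 1≤x 0≡x)
colLen≡1⇐ (y ∷ ys) _   (_ ∷ y∷ys≥) (refl , z<y) =
  trans (colLen-∷-≤ ys ≤-refl) (cong suc (colLen≡0 (Linked-tail y∷ys≥) z<y))

-- A row of length x above the rows xs has a cell of hook length 2 with arm 1 iff the next part is at most x − 2,
-- and one with leg 1 iff the next part is x and the one after it is smaller (rowLen xs i is 0 past the end).
rowHooks2 : ℕ → List ℕ → ℕ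
rowHooks2 x xs = 𝟙 (2 + rowLen xs 1 ≤? x) + 𝟙 ((rowLen xs 1 ≟ x) ×-dec (rowLen xs 2 <? x))

firstRowHook : ℕ → List ℕ → ℕ → ℕ
firstRowHook x xs j = (x ∸ suc j) + colLen xs (suc j) + 1

firstRow-hooks2-arm≥1 : ∀ k xs → Linked _≥_ xs →
                        length (filter (λ j → firstRowHook (suc k) xs j ≟ 2) (upTo k)) ≡ 𝟙 (2 + rowLen xs 1 ≤? suc k)
firstRow-hooks2-arm≥1 zero    xs _   = refl
firstRow-hooks2-arm≥1 (suc k) xs xs≥ = begin
  hooksAmong (upTo (suc k))            ≡⟨ cong hooksAmong (upTo-∷ʳ k) ⟨
  hooksAmong (upTo k ∷ʳ k)             ≡⟨ length-filter-∷ʳ isHook2? (upTo k) k ⟩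
  hooksAmong (upTo k) + 𝟙 (isHook2? k) ≡⟨ cong₂ _+_ noArm≥2 armOne ⟩
  𝟙 (2 + rowLen xs 1 ≤? 2 + k)         ∎
  where
  open ≡-Reasoning
  isHook2? : ∀ j → Dec (firstRowHook (2 + k) xs j ≡ 2)
  isHook2? j = firstRowHook (2 + k) xs j ≟ 2
  hooksAmong : List ℕ → ℕ
  hooksAmong js = length (filter isHook2? js)
  hook≥3 : ∀ {j} → j < k → 3 ≤ firstRowHook (2 + k) xs j
  hook≥3 {j} j<k = +-monoˡ-≤ 1 (≤-trans arm≥2 (m≤m+n (suc k ∸ j) (colLen xs (suc j))))
    where
    arm≥2 : 2 ≤ suc k ∸ j
    arm≥2 = subst (2 ≤_) (sym (+-∸-assoc 1 (<⇒≤ j<k))) (s≤s (m<n⇒0<n∸m j<k))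
  noArm≥2 : hooksAmong (upTo k) ≡ 0
  noArm≥2 = cong length (filter-none isHook2? (All.tabulate λ j∈ h≡2 → <⇒≢ (hook≥3 (∈-upTo⁻ j∈)) (sym h≡2)))
  legZero : firstRowHook (2 + k) xs k ≡ 2 → colLen xs (suc k) ≡ 0
  legZero h≡2 = suc-injective (+-cancelʳ-≡ 1 _ 1 (subst (λ arm → arm + colLen xs (suc k) + 1 ≡ 2) (m+n∸n≡m 1 k) h≡2))
  legZero⁻¹ : colLen xs (suc k) ≡ 0 → firstRowHook (2 + k) xs k ≡ 2
  legZero⁻¹ c≡0 rewrite m+n∸n≡m 1 k | c≡0 = refl
  armOne : 𝟙 (isHook2? k) ≡ 𝟙 (2 + rowLen xs 1 ≤? 2 + k)
  armOne = 𝟙-cong (isHook2? k) (2 + rowLen xs 1 ≤? 2 + k)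
                  (λ h≡2 → s≤s (colLen≡0⇒ xs (s≤s z≤n) (legZero h≡2)))
                  (λ { (s≤s h<k) → legZero⁻¹ (colLen≡0 xs≥ h<k) })

firstRow-hooks2 : ∀ x xs → Linked _≥_ (x ∷ xs) → length (filter (λ j → firstRowHook x xs j ≟ 2) (upTo x)) ≡ rowHooks2 x xs
firstRow-hooks2 zero    xs _     = sym (𝟙-no ((rowLen xs 1 ≟ 0) ×-dec (rowLen xs 2 <? 0)) λ ())
firstRow-hooks2 (suc a) xs x∷xs≥ = begin
  hooksAmong (upTo (suc a))            ≡⟨ cong hooksAmong (upTo-∷ʳ a) ⟨
  hooksAmong (upTo a ∷ʳ a)             ≡⟨ length-filter-∷ʳ isHook2? (upTo a) a ⟩
  hooksAmong (upTo a) + 𝟙 (isHook2? a) ≡⟨ cong₂ _+_ (firstRow-hooks2-arm≥1 a xs (Linked-tail x∷xs≥)) armZero ⟩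
  rowHooks2 (suc a) xs                 ∎
  where
  open ≡-Reasoning
  isHook2? : ∀ j → Dec (firstRowHook (suc a) xs j ≡ 2)
  isHook2? j = firstRowHook (suc a) xs j ≟ 2
  hooksAmong : List ℕ → ℕ
  hooksAmong js = length (filter isHook2? js)
  legOne : firstRowHook (suc a) xs a ≡ 2 → colLen xs (suc a) ≡ 1
  legOne h≡2 = +-cancelʳ-≡ 1 _ 1 (subst (λ arm → arm + colLen xs (suc a) + 1 ≡ 2) (n∸n≡0 a) h≡2)
  legOne⁻¹ : colLen xs (suc a) ≡ 1 → firstRowHook (suc a) xs a ≡ 2
  legOne⁻¹ c≡1 rewrite n∸n≡0 a | c≡1 = refl
  armZero : 𝟙 (isHook2? a) ≡ 𝟙 ((rowLen xs 1 ≟ suc a) ×-dec (rowLen xs 2 <? suc a))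
  armZero = 𝟙-cong (isHook2? a) ((rowLen xs 1 ≟ suc a) ×-dec (rowLen xs 2 <? suc a))
                   (colLen≡1⇒ xs (s≤s z≤n) x∷xs≥ ∘ legOne) (legOne⁻¹ ∘ colLen≡1⇐ xs (s≤s z≤n) x∷xs≥)

cells-∷ : ∀ x xs → cells (x ∷ xs) ≡ map (λ j → 1 , suc j) (upTo x) ++ map (map₁ suc) (cells xs)
cells-∷ x xs = cong (map (λ j → 1 , suc j) (upTo x) ++_) (begin
  concatMap (row (x ∷ xs)) (applyUpTo suc (length xs))
    ≡⟨ cong (concatMap (row (x ∷ xs))) (map-upTo suc (length xs)) ⟨
  concatMap (row (x ∷ xs)) (map suc (upTo (length xs)))
    ≡⟨ concatMap-map (row (x ∷ xs)) suc (upTo (length xs)) ⟩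
  concatMap (row (x ∷ xs) ∘ suc) (upTo (length xs))
    ≡⟨ concatMap-cong (λ i → map-∘ (upTo (rowLen xs (suc i)))) (upTo (length xs)) ⟩
  concatMap (map (map₁ suc) ∘ row xs) (upTo (length xs))
    ≡⟨ map-concatMap (map₁ suc) (row xs) (upTo (length xs)) ⟨
  map (map₁ suc) (cells xs)
    ∎)
  where
  open ≡-Reasoning
  row : List ℕ → ℕ → List (ℕ × ℕ)
  row λs i = map (λ j → suc i , suc j) (upTo (rowLen λs (suc i)))

∈-cells⁻ : ∀ {λs c} → c ∈ cells λs → ∃₂ λ i j → c ≡ (suc i , suc j) × j < rowLen λs (suc i)
∈-cells⁻ {λs} c∈
  with Any.satisfied (∈-concatMap⁻ (λ i → map (λ j → suc i , suc j) (upTo (rowLen λs (suc i)))) {xs = upTo (length λs)} c∈)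
... | i , c∈row with ∈-map⁻ (λ j → suc i , suc j) c∈row
...   | j , j∈ , c≡ = i , j , c≡ , ∈-upTo⁻ j∈

hook-firstRow : ∀ {x} xs {j} → j < x → hook (x ∷ xs) 1 (suc j) ≡ firstRowHook x xs j
hook-firstRow xs j<x rewrite colLen-∷-≤ xs j<x = refl

hook-lowerRow : ∀ {x xs} → Linked _≥_ (x ∷ xs) → ∀ {c} → c ∈ cells xs →
                hook (x ∷ xs) (suc (proj₁ c)) (proj₂ c) ≡ hook xs (proj₁ c) (proj₂ c)
hook-lowerRow {x} {xs} x∷xs≥ c∈ with ∈-cells⁻ {xs} c∈
... | i , j , refl , j<row rewrite colLen-∷-≤ xs (≤-trans j<row (rowLen-≤ (head-≥ x∷xs≥) (suc i))) = refl

hooks2-∷ : ∀ {x xs} → Linked _≥_ (x ∷ xs) → hooks2 (x ∷ xs) ≡ rowHooks2 x xs + hooks2 xs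
hooks2-∷ {x} {xs} x∷xs≥ = begin
  hooks2 (x ∷ xs)
    ≡⟨ cong (length ∘ filter isHook2?) (cells-∷ x xs) ⟩
  length (filter isHook2? (map (λ j → 1 , suc j) (upTo x) ++ map (map₁ suc) (cells xs)))
    ≡⟨ length-filter-++ isHook2? (map (λ j → 1 , suc j) (upTo x)) _ ⟩
  length (filter isHook2? (map (λ j → 1 , suc j) (upTo x))) + length (filter isHook2? (map (map₁ suc) (cells xs)))
    ≡⟨ cong₂ _+_ (length-filter-map isHook2? _ (upTo x)) (length-filter-map isHook2? (map₁ suc) (cells xs)) ⟩
  length (filter (λ j → hook (x ∷ xs) 1 (suc j) ≟ 2) (upTo x))
    + length (filter (λ c → hook (x ∷ xs) (suc (proj₁ c)) (proj₂ c) ≟ 2) (cells xs))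
    ≡⟨ cong₂ _+_ (length-filter-cong _ _ (upTo x) (λ j∈ → trans (sym (hook-firstRow xs (∈-upTo⁻ j∈))))
                                                  (λ j∈ → trans (hook-firstRow xs (∈-upTo⁻ j∈))))
                 (length-filter-cong _ _ (cells xs) (λ c∈ → trans (sym (hook-lowerRow x∷xs≥ c∈)))
                                                    (λ c∈ → trans (hook-lowerRow x∷xs≥ c∈))) ⟩
  length (filter (λ j → firstRowHook x xs j ≟ 2) (upTo x)) + hooks2 xs
    ≡⟨ cong (_+ hooks2 xs) (firstRow-hooks2 x xs x∷xs≥) ⟩
  rowHooks2 x xs + hooks2 xs
    ∎
  where
  open ≡-Reasoning
  isHook2? : ∀ c → Dec (hook (x ∷ xs) (proj₁ c) (proj₂ c) ≡ 2)
  isHook2? (i , j) = hook (x ∷ xs) i j ≟ 2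

rowHooks2≤1 : ∀ x xs → rowHooks2 x xs ≤ 1
rowHooks2≤1 x xs = atMostOne (2 + rowLen xs 1 ≤? x) ((rowLen xs 1 ≟ x) ×-dec (rowLen xs 2 <? x))
  where
  atMostOne : (armOne : Dec (2 + rowLen xs 1 ≤ x)) (legOne : Dec (rowLen xs 1 ≡ x × rowLen xs 2 < x)) → 𝟙 armOne + 𝟙 legOne ≤ 1
  atMostOne (yes 2+h≤x) legOne = ≤-reflexive (cong suc (𝟙-no legOne λ (h≡x , _) → <⇒≢ (≤-trans (n≤1+n _) 2+h≤x) h≡x))
  atMostOne (no _)      legOne = 𝟙≤1 legOne

hooks2≤length : ∀ {λs} → Linked _≥_ λs → hooks2 λs ≤ length λs
hooks2≤length {[]}     _      = z≤n
hooks2≤length {x ∷ xs} x∷xs≥ =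
  subst (_≤ suc (length xs)) (sym (hooks2-∷ x∷xs≥)) (+-mono-≤ (rowHooks2≤1 x xs) (hooks2≤length (Linked-tail x∷xs≥)))

hook2Rows : List ℕ → List ℕ
hook2Rows []       = []
hook2Rows (x ∷ xs) = replicate (rowHooks2 x xs) x ++ hook2Rows xs

length-hook2Rows : ∀ {λs} → Linked _≥_ λs → length (hook2Rows λs) ≡ hooks2 λs
length-hook2Rows {[]}     _      = refl
length-hook2Rows {x ∷ xs} x∷xs≥ = begin
  length (replicate (rowHooks2 x xs) x ++ hook2Rows xs)
    ≡⟨ length-++ (replicate (rowHooks2 x xs) x) ⟩
  length (replicate (rowHooks2 x xs) x) + length (hook2Rows xs)
    ≡⟨ cong₂ _+_ (length-replicate (rowHooks2 x xs)) (length-hook2Rows (Linked-tail x∷xs≥)) ⟩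
  rowHooks2 x xs + hooks2 xs
    ≡⟨ hooks2-∷ x∷xs≥ ⟨
  hooks2 (x ∷ xs)
    ∎
  where open ≡-Reasoning

hook2Rows-All : ∀ {p} {P : ℕ → Set p} {μ} → All P μ → All P (hook2Rows μ)
hook2Rows-All {μ = []}     []         = []
hook2Rows-All {μ = x ∷ xs} (px ∷ pxs) = Allₚ.++⁺ (Allₚ.replicate⁺ (rowHooks2 x xs) px) (hook2Rows-All pxs)

hook2Rows-sorted : ∀ {μ} → Linked _≥_ μ → AllPairs _≥_ (hook2Rows μ)
hook2Rows-sorted {[]}     _      = []
hook2Rows-sorted {x ∷ xs} x∷xs≥ =
  AllPairsₚ.++⁺ (AllPairs-replicate (rowHooks2 x xs) ≤-refl) (hook2Rows-sorted (Linked-tail x∷xs≥))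
                (Allₚ.replicate⁺ (rowHooks2 x xs) (hook2Rows-All (head-≥ x∷xs≥)))

-- Partitions into distinct parts

removeStaircase : List ℕ → List ℕ
removeStaircase []       = []
removeStaircase (x ∷ xs) = x ∸ suc (length xs) ∷ removeStaircase xs

addStaircase : List ℕ → List ℕ
addStaircase []       = []
addStaircase (w ∷ ws) = w + suc (length ws) ∷ addStaircase ws

triangle : ℕ → ℕ
triangle zero    = 0
triangle (suc n) = suc n + triangle n

length-removeStaircase : ∀ xs → length (removeStaircase xs) ≡ length xs
length-removeStaircase []       = refl
length-removeStaircase (x ∷ xs) = cong suc (length-removeStaircase xs)

length-addStaircase : ∀ ws → length (addStaircase ws) ≡ length ws
length-addStaircase []       = refl
length-addStaircase (w ∷ ws) = cong suc (length-addStaircase ws)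

length<head : ∀ {x xs} → Linked _>_ (x ∷ xs) → All (0 <_) (x ∷ xs) → length xs < x
length<head {xs = []}     _             (0<x ∷ _)  = 0<x
length<head {xs = y ∷ ys} (y<x ∷ y∷ys>) (_ ∷ 0<ys) = ≤-trans (s≤s (length<head y∷ys> 0<ys)) y<x

next<head : ∀ {x xs} → Linked _>_ (x ∷ xs) → 0 < x → rowLen xs 1 < x
next<head [-]       0<x = 0<x
next<head (y<x ∷ _) _   = y<x

length≤head : ∀ {xs} → Linked _>_ xs → All (0 <_) xs → length xs ≤ rowLen xs 1
length≤head {[]}    _    _   = z≤n
length≤head {_ ∷ _} xs> 0<xs = length<head xs> 0<xs

addStaircase-removeStaircase : ∀ {xs} → Linked _>_ xs → All (0 <_) xs → addStaircase (removeStaircase xs) ≡ xs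
addStaircase-removeStaircase {[]}     _      _             = refl
addStaircase-removeStaircase {x ∷ xs} x∷xs> 0<x∷xs@(_ ∷ 0<xs) = cong₂ _∷_
  (trans (cong (λ ℓ → x ∸ suc (length xs) + suc ℓ) (length-removeStaircase xs)) (m∸n+n≡m (length<head x∷xs> 0<x∷xs)))
  (addStaircase-removeStaircase (Linked-tail x∷xs>) 0<xs)

removeStaircase-addStaircase : ∀ ws → removeStaircase (addStaircase ws) ≡ ws
removeStaircase-addStaircase []       = refl
removeStaircase-addStaircase (w ∷ ws) = cong₂ _∷_
  (trans (cong (λ ℓ → w + suc (length ws) ∸ suc ℓ) (length-addStaircase ws)) (m+n∸n≡m w (suc (length ws))))
  (removeStaircase-addStaircase ws)

removeStaircase-sorted : ∀ {xs} → Linked _>_ xs → Linked _≥_ (removeStaircase xs)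
removeStaircase-sorted []               = []
removeStaircase-sorted [-]              = [-]
removeStaircase-sorted (y<x ∷ y∷ys>) = ∸-monoˡ-≤ (2 + _) y<x ∷ removeStaircase-sorted y∷ys>

addStaircase-strict : ∀ {ws} → Linked _≥_ ws → Linked _>_ (addStaircase ws)
addStaircase-strict []            = []
addStaircase-strict [-]           = [-]
addStaircase-strict {w ∷ v ∷ vs} (v≤w ∷ v∷vs≥) =
  subst (_≤ w + (2 + length vs)) (+-suc v (suc (length vs))) (+-monoˡ-≤ (2 + length vs) v≤w) ∷ addStaircase-strict v∷vs≥

addStaircase-positive : ∀ ws → All (0 <_) (addStaircase ws)
addStaircase-positive []       = []
addStaircase-positive (w ∷ ws) = subst (0 <_) (sym (+-suc w (length ws))) (s≤s z≤n) ∷ addStaircase-positive ws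

sum-addStaircase : ∀ ws → sum (addStaircase ws) ≡ triangle (length ws) + sum ws
sum-addStaircase []       = refl
sum-addStaircase (w ∷ ws) rewrite sum-addStaircase ws =
  solve 4 (λ w ℓ t s → w :+ (con 1 :+ ℓ) :+ (t :+ s) := con 1 :+ ℓ :+ t :+ (w :+ s)) refl w (length ws) (triangle (length ws)) (sum ws)

sum-removeStaircase : ∀ {xs} → Linked _>_ xs → All (0 <_) xs → sum xs ≡ triangle (length xs) + sum (removeStaircase xs)
sum-removeStaircase {xs} xs> 0<xs = begin
  sum xs
    ≡⟨ cong sum (addStaircase-removeStaircase xs> 0<xs) ⟨
  sum (addStaircase (removeStaircase xs))
    ≡⟨ sum-addStaircase (removeStaircase xs) ⟩
  triangle (length (removeStaircase xs)) + sum (removeStaircase xs)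
    ≡⟨ cong (λ ℓ → triangle ℓ + sum (removeStaircase xs)) (length-removeStaircase xs) ⟩
  triangle (length xs) + sum (removeStaircase xs)
    ∎
  where open ≡-Reasoning

-- On a weakly decreasing list: its distinct nonzero parts.
distinctParts : List ℕ → List ℕ
distinctParts []       = []
distinctParts (w ∷ ws) with rowLen ws 1 <? w
... | yes _ = w ∷ distinctParts ws
... | no  _ = distinctParts ws

length-distinctParts-∷ : ∀ w ws → length (distinctParts (w ∷ ws)) ≡ 𝟙 (rowLen ws 1 <? w) + length (distinctParts ws)
length-distinctParts-∷ w ws with rowLen ws 1 <? w
... | yes h<w = cong (_+ length (distinctParts ws)) (sym (𝟙-yes (rowLen ws 1 <? w) h<w))
... | no  h≮w = cong (_+ length (distinctParts ws)) (sym (𝟙-no (rowLen ws 1 <? w) h≮w))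

distinctParts-⊆ : ∀ {ws} → distinctParts ws ⊆ ws
distinctParts-⊆ {w ∷ ws} v∈ with rowLen ws 1 <? w | v∈
... | yes _ | here refl = here refl
... | yes _ | there v∈′ = there (distinctParts-⊆ v∈′)
... | no  _ | v∈′       = there (distinctParts-⊆ v∈′)

distinctParts-strict : ∀ {ws} → Linked _≥_ ws → AllPairs _>_ (distinctParts ws)
distinctParts-strict {[]}     _      = []
distinctParts-strict {w ∷ ws} w∷ws≥ with rowLen ws 1 <? w
... | yes h<w = All.tabulate (λ v∈ → ≤-<-trans (∈⇒≤head (Linked-tail w∷ws≥) (distinctParts-⊆ v∈)) h<w)
                ∷ distinctParts-strict (Linked-tail w∷ws≥)
... | no  _   = distinctParts-strict (Linked-tail w∷ws≥)

distinctParts-positive : ∀ ws → All (0 <_) (distinctParts ws)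
distinctParts-positive []       = []
distinctParts-positive (w ∷ ws) with rowLen ws 1 <? w
... | yes h<w = ≤-<-trans z≤n h<w ∷ distinctParts-positive ws
... | no  _   = distinctParts-positive ws

head-removeStaircase : ∀ xs → rowLen (removeStaircase xs) 1 ≡ rowLen xs 1 ∸ length xs
head-removeStaircase []      = refl
head-removeStaircase (_ ∷ _) = refl

gap≥2⇔descent : ∀ {h x ℓ} → ℓ ≤ h → ℓ < x → (2 + h ≤ x) ⇔ (h ∸ ℓ < x ∸ suc ℓ)
gap≥2⇔descent {h} {x} {ℓ} ℓ≤h ℓ<x = mk⇔
  (λ 2+h≤x → subst (_≤ x ∸ suc ℓ) (+-∸-assoc 1 ℓ≤h) (∸-monoˡ-≤ (suc ℓ) 2+h≤x))
  (λ descent → subst₂ _≤_ shift-back (m+[n∸m]≡n ℓ<x) (+-monoʳ-≤ (suc ℓ) descent))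
  where
  shift-back : suc ℓ + suc (h ∸ ℓ) ≡ 2 + h
  shift-back = cong suc (trans (+-suc ℓ (h ∸ ℓ)) (cong suc (m+[n∸m]≡n ℓ≤h)))

hooks2-distinct : ∀ {λs} → Linked _>_ λs → All (0 <_) λs → hooks2 λs ≡ length (distinctParts (removeStaircase λs))
hooks2-distinct {[]}     _      _                = refl
hooks2-distinct {x ∷ xs} x∷xs> 0<x∷xs@(_ ∷ 0<xs) = begin
  hooks2 (x ∷ xs)
    ≡⟨ hooks2-∷ (Linked.map <⇒≤ x∷xs>) ⟩
  rowHooks2 x xs + hooks2 xs
    ≡⟨ cong₂ _+_ rowHooks2-descent (hooks2-distinct (Linked-tail x∷xs>) 0<xs) ⟩
  𝟙 (rowLen w 1 <? x ∸ suc ℓ) + length (distinctParts w)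
    ≡⟨ length-distinctParts-∷ (x ∸ suc ℓ) w ⟨
  length (distinctParts (removeStaircase (x ∷ xs)))
    ∎
  where
  open ≡-Reasoning
  ℓ : ℕ
  ℓ = length xs
  w : List ℕ
  w = removeStaircase xs
  h<x : rowLen xs 1 < x
  h<x = next<head x∷xs> (All.head 0<x∷xs)
  gap⇔ : (2 + rowLen xs 1 ≤ x) ⇔ (rowLen xs 1 ∸ ℓ < x ∸ suc ℓ)
  gap⇔ = gap≥2⇔descent (length≤head (Linked-tail x∷xs>) 0<xs) (length<head x∷xs> 0<x∷xs)
  rowHooks2-descent : rowHooks2 x xs ≡ 𝟙 (rowLen w 1 <? x ∸ suc ℓ)
  rowHooks2-descent = begin
    𝟙 (2 + rowLen xs 1 ≤? x) + 𝟙 ((rowLen xs 1 ≟ x) ×-dec (rowLen xs 2 <? x))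
      ≡⟨ cong (𝟙 (2 + rowLen xs 1 ≤? x) +_) (𝟙-no ((rowLen xs 1 ≟ x) ×-dec (rowLen xs 2 <? x)) ((<⇒≢ h<x) ∘ proj₁)) ⟩
    𝟙 (2 + rowLen xs 1 ≤? x) + 0
      ≡⟨ +-identityʳ _ ⟩
    𝟙 (2 + rowLen xs 1 ≤? x)
      ≡⟨ 𝟙-cong (2 + rowLen xs 1 ≤? x) (rowLen w 1 <? x ∸ suc ℓ)
                (subst (_< x ∸ suc ℓ) (sym (head-removeStaircase xs)) ∘ Equivalence.to gap⇔)
                (Equivalence.from gap⇔ ∘ subst (_< x ∸ suc ℓ) (head-removeStaircase xs)) ⟩
    𝟙 (rowLen w 1 <? x ∸ suc ℓ)
      ∎

-- Partitions into odd parts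

odd⇒positive : ∀ {a} → Odd a → 0 < a
odd⇒positive {suc _} _ = s≤s z≤n

odd+2* : ∀ {a} h → Odd a → Odd (a + 2 * h)
odd+2* {a} h odd-a = trans (cong (λ t → (a + t) % 2) (*-comm 2 h)) (trans ([m+kn]%n≡m%n a h 2) odd-a)

odd-gap : ∀ {a b} → Odd a → Odd b → b < a → 2 + b ≤ a
odd-gap {a} {b} odd-a odd-b b<a with m≤n⇒m<n∨m≡n b<a
... | inj₁ 1+b<a  = 1+b<a
... | inj₂ refl with () ← trans (sym odd-a) (trans (%-distribˡ-+ 1 b 2) (cong (λ r → (1 + r) % 2) odd-b))

%2≤1 : ∀ n → n % 2 ≤ 1
%2≤1 n = ≤-pred (m%n<n n 2)

%2-/2-injective : ∀ {m n} → m % 2 ≡ n % 2 → m / 2 ≡ n / 2 → m ≡ n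
%2-/2-injective {m} {n} m%2≡ m/2≡ = begin
  m                    ≡⟨ m≡m%n+[m/n]*n m 2 ⟩
  m % 2 + m / 2 * 2    ≡⟨ cong₂ (λ p h → p + h * 2) m%2≡ m/2≡ ⟩
  n % 2 + n / 2 * 2    ≡⟨ m≡m%n+[m/n]*n n 2 ⟨
  n                    ∎
  where open ≡-Reasoning

count-hook2Rows-∷ : ∀ a x xs → count a (hook2Rows (x ∷ xs)) ≡ 𝟙 (a ≟ x) * rowHooks2 x xs + count a (hook2Rows xs)
count-hook2Rows-∷ a x xs = trans (count-++ a (replicate (rowHooks2 x xs) x) (hook2Rows xs))
                                 (cong (_+ count a (hook2Rows xs)) (count-replicate a (rowHooks2 x xs) x))

count-below-head : ∀ {a xs} → Linked _≥_ xs → rowLen xs 1 < a → count a xs ≡ 0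
count-below-head {a} xs≥ h<a =
  cong length (filter-none (a ≟_) (All.tabulate λ v∈ a≡v → <⇒≢ (≤-<-trans (∈⇒≤head xs≥ v∈) h<a) (sym a≡v)))

armOne≤rowHooks2 : ∀ x xs → 2 + rowLen xs 1 ≤ x → 1 ≤ rowHooks2 x xs
armOne≤rowHooks2 x xs gap = ≤-trans (≤-reflexive (sym (𝟙-yes (2 + rowLen xs 1 ≤? x) gap))) (m≤m+n _ _)

legOne≤rowHooks2 : ∀ x xs → rowLen xs 1 ≡ x → rowLen xs 2 < x → 1 ≤ rowHooks2 x xs
legOne≤rowHooks2 x xs h≡x z<x =
  ≤-trans (≤-reflexive (sym (𝟙-yes ((rowLen xs 1 ≟ x) ×-dec (rowLen xs 2 <? x)) (h≡x , z<x)))) (m≤n+m _ _)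

repeatedPart-hooks2 : ∀ {a} ys → 2 ≤ a → Linked _≥_ (a ∷ ys) →
                      2 ⊓ suc (count a ys) ≤ count a (hook2Rows (a ∷ ys)) → 2 ≤ rowHooks2 a (a ∷ ys) + count a (hook2Rows (a ∷ ys))
repeatedPart-hooks2 {a} []       2≤a _         IH = +-mono-≤ (legOne≤rowHooks2 a (a ∷ []) refl (≤-trans (s≤s z≤n) 2≤a)) IH
repeatedPart-hooks2 {a} (z ∷ zs) _   (z≤a ∷ _) IH with m≤n⇒m<n∨m≡n z≤a
... | inj₁ z<a  = +-mono-≤ (legOne≤rowHooks2 a (a ∷ z ∷ zs) refl z<a) (≤-trans (s≤s z≤n) IH)
... | inj₂ refl = ≤-trans (subst (λ c → 2 ⊓ suc c ≤ count a (hook2Rows (a ∷ a ∷ zs))) (count-self a zs) IH) (m≤n+m _ _)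

min2-count≤count-hook2Rows-∷ : ∀ {a} xs → 2 ≤ a → Odd a → Linked _≥_ (a ∷ xs) → AllOdd xs →
                               2 ⊓ count a xs ≤ count a (hook2Rows xs) →
                               2 ⊓ suc (count a xs) ≤ rowHooks2 a xs + count a (hook2Rows xs)
min2-count≤count-hook2Rows-∷ {a} [] 2≤a _ _ _ _ = ≤-trans (armOne≤rowHooks2 a [] 2≤a) (m≤m+n _ 0)
min2-count≤count-hook2Rows-∷ {a} (y ∷ ys) 2≤a odd-a (y≤a ∷ y∷ys≥) (odd-y ∷ _) IH with m≤n⇒m<n∨m≡n y≤a
... | inj₁ y<a rewrite count-below-head y∷ys≥ y<a =
  ≤-trans (armOne≤rowHooks2 a (y ∷ ys) (odd-gap odd-a odd-y y<a)) (m≤m+n _ _)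
... | inj₂ refl =
  subst (λ c → 2 ⊓ suc c ≤ rowHooks2 a (a ∷ ys) + count a (hook2Rows (a ∷ ys))) (sym (count-self a ys))
        (repeatedPart-hooks2 ys 2≤a y∷ys≥ (subst (λ c → 2 ⊓ c ≤ count a (hook2Rows (a ∷ ys))) (count-self a ys) IH))

min2-count≤count-hook2Rows : ∀ {a μ} → 2 ≤ a → Linked _≥_ μ → AllOdd μ → 2 ⊓ count a μ ≤ count a (hook2Rows μ)
min2-count≤count-hook2Rows {a} {[]}     _   _      _                 = z≤n
min2-count≤count-hook2Rows {a} {x ∷ xs} 2≤a x∷xs≥ (odd-x ∷ odd-xs) =
  subst₂ (λ c c′ → 2 ⊓ c ≤ c′) (sym (count-∷ a x xs)) (sym (count-hook2Rows-∷ a x xs)) (split (a ≟ x))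
  where
  IH : 2 ⊓ count a xs ≤ count a (hook2Rows xs)
  IH = min2-count≤count-hook2Rows 2≤a (Linked-tail x∷xs≥) odd-xs
  split : (a≟x : Dec (a ≡ x)) → 2 ⊓ (𝟙 a≟x + count a xs) ≤ 𝟙 a≟x * rowHooks2 x xs + count a (hook2Rows xs)
  split (no  _)    = IH
  split (yes refl) = subst (λ r → 2 ⊓ suc (count a xs) ≤ r + count a (hook2Rows xs)) (sym (*-identityˡ (rowHooks2 a xs)))
                           (min2-count≤count-hook2Rows-∷ xs 2≤a odd-x x∷xs≥ odd-xs IH)

∈-hook2Rows : ∀ {a μ} → 2 ≤ a → Linked _≥_ μ → AllOdd μ → a ∈ μ → a ∈ hook2Rows μ
∈-hook2Rows {a} {μ} 2≤a μ≥ odd-μ a∈μ =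
  count>0⇒∈ (hook2Rows μ) (≤-trans (⊓-glb (s≤s z≤n) (∈⇒count>0 a∈μ)) (min2-count≤count-hook2Rows 2≤a μ≥ odd-μ))

pair∈pairsOf-hook2Rows : ∀ {a b rest μ} → 2 ≤ b → b ≤ a → a ∷ b ∷ rest ↭ μ → Linked _≥_ μ → AllOdd μ →
                         (a , b) ∈ pairsOf (hook2Rows μ)
pair∈pairsOf-hook2Rows {a} {b} {rest} {μ} 2≤b b≤a ab∷rest↭μ μ≥ odd-μ with m≤n⇒m<n∨m≡n b≤a
... | inj₁ b<a  = ∈-pairsOf-< (hook2Rows-sorted μ≥) b<a
                              (∈-hook2Rows (≤-trans 2≤b (<⇒≤ b<a)) μ≥ odd-μ (∈-resp-↭ ab∷rest↭μ (here refl)))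
                              (∈-hook2Rows 2≤b μ≥ odd-μ (∈-resp-↭ ab∷rest↭μ (there (here refl))))
... | inj₂ refl = ∈-pairsOf-≡ (hook2Rows μ)
                              (≤-trans (≤-reflexive (sym (m≤n⇒m⊓n≡m twice))) (min2-count≤count-hook2Rows 2≤b μ≥ odd-μ))
  where
  count-aa : count a (a ∷ a ∷ rest) ≡ 2 + count a rest
  count-aa = trans (count-self a (a ∷ rest)) (cong suc (count-self a rest))
  twice : 2 ≤ count a μ
  twice = subst (2 ≤_) (trans (sym count-aa) (count-↭ a ab∷rest↭μ)) (s≤s (s≤s z≤n))

-- Glaisher's map

-- Writes k as 2 ^ e * o with o odd, halving at most fuel times, which suffices when 0 < k ≤ fuel.
twoAdic : ℕ → ℕ → ℕ × ℕ
twoAdic (suc fuel) (suc (suc j)) with j % 2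
... | zero  = map₁ suc (twoAdic fuel (suc (j / 2)))
... | suc _ = 0 , suc (suc j)
twoAdic _          k             = 0 , k

twoAdic-spec : ∀ fuel k → 0 < k → k ≤ fuel →
               2 ^ proj₁ (twoAdic fuel k) * proj₂ (twoAdic fuel k) ≡ k × Odd (proj₂ (twoAdic fuel k))
twoAdic-spec (suc fuel) (suc zero)    _ _         = refl , refl
twoAdic-spec (suc fuel) (suc (suc j)) _ (s≤s 1+j≤fuel) with j % 2 in j%2
... | zero  = power≡ , proj₂ IH
  where
  e o : ℕ
  e = proj₁ (twoAdic fuel (suc (j / 2)))
  o = proj₂ (twoAdic fuel (suc (j / 2)))
  IH : 2 ^ e * o ≡ suc (j / 2) × Odd o
  IH = twoAdic-spec fuel (suc (j / 2)) (s≤s z≤n) (≤-trans (s≤s (m/n≤m j 2)) 1+j≤fuel)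
  power≡ : 2 * 2 ^ e * o ≡ suc (suc j)
  power≡ = begin
    2 * 2 ^ e * o               ≡⟨ *-assoc 2 (2 ^ e) o ⟩
    2 * (2 ^ e * o)             ≡⟨ cong (2 *_) (proj₁ IH) ⟩
    2 * suc (j / 2)             ≡⟨ *-suc 2 (j / 2) ⟩
    2 + 2 * (j / 2)             ≡⟨ cong (2 +_) (*-comm 2 (j / 2)) ⟩
    2 + (j / 2) * 2             ≡⟨ cong (λ r → 2 + (r + (j / 2) * 2)) j%2 ⟨
    2 + (j % 2 + (j / 2) * 2)   ≡⟨ cong (2 +_) (m≡m%n+[m/n]*n j 2) ⟨
    2 + j                       ∎
    where open ≡-Reasoning
... | suc r = +-identityʳ (suc (suc j)) , trans j%2 (cong suc (n≤0⇒n≡0 (≤-pred (≤-pred (subst (_< 2) j%2 (m%n<n j 2))))))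

exponent oddPart : ℕ → ℕ
exponent k = proj₁ (twoAdic k k)
oddPart  k = proj₂ (twoAdic k k)

exponent-oddPart : ∀ {k} → 0 < k → 2 ^ exponent k * oddPart k ≡ k
exponent-oddPart {k} 0<k = proj₁ (twoAdic-spec k k 0<k ≤-refl)

oddPart-odd : ∀ {k} → 0 < k → Odd (oddPart k)
oddPart-odd {k} 0<k = proj₂ (twoAdic-spec k k 0<k ≤-refl)

glaisher : List ℕ → List ℕ
glaisher = concatMap (λ k → replicate (2 ^ exponent k) (oddPart k))

glaisher-odd : ∀ {κ} → All (0 <_) κ → AllOdd (glaisher κ)
glaisher-odd {[]}     []           = []
glaisher-odd {k ∷ κ} (0<k ∷ 0<κ) = Allₚ.++⁺ (Allₚ.replicate⁺ (2 ^ exponent k) (oddPart-odd 0<k)) (glaisher-odd 0<κ)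

sum-glaisher : ∀ {κ} → All (0 <_) κ → sum (glaisher κ) ≡ sum κ
sum-glaisher {[]}     []           = refl
sum-glaisher {k ∷ κ} (0<k ∷ 0<κ) = begin
  sum (replicate (2 ^ exponent k) (oddPart k) ++ glaisher κ)
    ≡⟨ sum-++ (replicate (2 ^ exponent k) (oddPart k)) (glaisher κ) ⟩
  sum (replicate (2 ^ exponent k) (oddPart k)) + sum (glaisher κ)
    ≡⟨ cong₂ _+_ (trans (sum-replicate (2 ^ exponent k) (oddPart k)) (exponent-oddPart 0<k)) (sum-glaisher 0<κ) ⟩
  k + sum κ
    ∎
  where open ≡-Reasoning

count-glaisher-∷ : ∀ o k κ → count o (glaisher (k ∷ κ)) ≡ 𝟙 (o ≟ oddPart k) * 2 ^ exponent k + count o (glaisher κ)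
count-glaisher-∷ o k κ = trans (count-++ o (replicate (2 ^ exponent k) (oddPart k)) (glaisher κ))
                               (cong (_+ count o (glaisher κ)) (count-replicate o (2 ^ exponent k) (oddPart k)))

exponent-mono : ∀ {e₁ e₂ o} → 2 ^ e₁ * o < 2 ^ e₂ * o → e₁ < e₂
exponent-mono {e₁} {e₂} {o} lt with e₁ <? e₂
... | yes e₁<e₂ = e₁<e₂
... | no  e₁≮e₂ = ⊥-elim (<⇒≱ lt (*-monoˡ-≤ o (^-monoʳ-≤ 2 (≮⇒≥ e₁≮e₂))))

count-glaisher-< : ∀ {e o κ} → Odd o → Linked _>_ κ → All (0 <_) κ → All (_< 2 ^ e * o) κ → count o (glaisher κ) < 2 ^ e
count-glaisher-< {e}     {κ = []}    _     _      _          _               = m^n>0 2 e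
count-glaisher-< {e} {o} {κ = k ∷ κ} odd-o k∷κ> (0<k ∷ 0<κ) (k<2ᵉo ∷ κ<2ᵉo) =
  subst (_< 2 ^ e) (sym (count-glaisher-∷ o k κ)) (split (o ≟ oddPart k))
  where
  split : (o≟ : Dec (o ≡ oddPart k)) → 𝟙 o≟ * 2 ^ exponent k + count o (glaisher κ) < 2 ^ e
  split (no  _)    = count-glaisher-< {e} odd-o (Linked-tail k∷κ>) 0<κ κ<2ᵉo
  split (yes refl) = begin-strict
    1 * 2 ^ exponent k + count o (glaisher κ)
      <⟨ +-monoʳ-< (1 * 2 ^ exponent k) (count-glaisher-< {exponent k} odd-o (Linked-tail k∷κ>) 0<κ κ<k) ⟩
    1 * 2 ^ exponent k + 2 ^ exponent k
      ≡⟨ cong (_+ 2 ^ exponent k) (*-identityˡ (2 ^ exponent k)) ⟩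
    2 ^ exponent k + 2 ^ exponent k
      ≡⟨ cong (2 ^ exponent k +_) (+-identityʳ (2 ^ exponent k)) ⟨
    2 ^ suc (exponent k)
      ≤⟨ ^-monoʳ-≤ 2 (exponent-mono {exponent k} {e} {o} (subst (_< 2 ^ e * o) (sym (exponent-oddPart 0<k)) k<2ᵉo)) ⟩
    2 ^ e
      ∎
    where
    open ≤-Reasoning
    κ<k : All (_< 2 ^ exponent k * o) κ
    κ<k = subst (λ k′ → All (_< k′) κ) (sym (exponent-oddPart 0<k)) (head-> k∷κ>)

2^exponent≤count-glaisher : ∀ k κ → 2 ^ exponent k ≤ count (oddPart k) (glaisher (k ∷ κ))
2^exponent≤count-glaisher k κ = begin
  2 ^ exponent k
    ≡⟨ *-identityˡ (2 ^ exponent k) ⟨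
  1 * 2 ^ exponent k
    ≡⟨ cong (_* 2 ^ exponent k) (𝟙-yes (oddPart k ≟ oddPart k) refl) ⟨
  𝟙 (oddPart k ≟ oddPart k) * 2 ^ exponent k
    ≤⟨ m≤m+n _ _ ⟩
  𝟙 (oddPart k ≟ oddPart k) * 2 ^ exponent k + count (oddPart k) (glaisher κ)
    ≡⟨ count-glaisher-∷ (oddPart k) k κ ⟨
  count (oddPart k) (glaisher (k ∷ κ))
    ∎
  where open ≤-Reasoning

glaisher-largestPart : ∀ {k κ κ′} → Linked _>_ (k ∷ κ) → All (0 <_) (k ∷ κ) →
                       Linked _>_ κ′ → All (0 <_) κ′ → All (_< k) κ′ → ¬ (glaisher (k ∷ κ) ↭ glaisher κ′)
glaisher-largestPart {k} {κ} {κ′} _ (0<k ∷ _) κ′> 0<κ′ κ′<k g↭g′ = <⇒≱ fewer more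
  where
  fewer : count (oddPart k) (glaisher κ′) < 2 ^ exponent k
  fewer = count-glaisher-< {exponent k} (oddPart-odd 0<k) κ′> 0<κ′
                           (subst (λ k′ → All (_< k′) κ′) (sym (exponent-oddPart 0<k)) κ′<k)
  more : 2 ^ exponent k ≤ count (oddPart k) (glaisher κ′)
  more = subst (2 ^ exponent k ≤_) (count-↭ (oddPart k) g↭g′) (2^exponent≤count-glaisher k κ)

glaisher-injective : ∀ {κ κ′} → Linked _>_ κ → Linked _>_ κ′ → All (0 <_) κ → All (0 <_) κ′ →
                     glaisher κ ↭ glaisher κ′ → κ ≡ κ′
glaisher-injective {[]}    {[]}      _    _     _   _    _   = refl
glaisher-injective {[]}    {k′ ∷ κ′} _    k′∷κ′> _  0<κ′ g↭g′ = ⊥-elim (glaisher-largestPart k′∷κ′> 0<κ′ [] [] [] (↭-sym g↭g′))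
glaisher-injective {k ∷ κ} {[]}      k∷κ> _     0<κ _    g↭g′ = ⊥-elim (glaisher-largestPart k∷κ> 0<κ [] [] [] g↭g′)
glaisher-injective {k ∷ κ} {k′ ∷ κ′} k∷κ> k′∷κ′> 0<κ 0<κ′ g↭g′ with <-cmp k k′
... | tri< k<k′ _ _ = ⊥-elim (glaisher-largestPart k′∷κ′> 0<κ′ k∷κ> 0<κ (All-<-∷ k∷κ> k<k′) (↭-sym g↭g′))
... | tri> _ _ k′<k = ⊥-elim (glaisher-largestPart k∷κ> 0<κ k′∷κ′> 0<κ′ (All-<-∷ k′∷κ′> k′<k) g↭g′)
... | tri≈ _ refl _ = cong (k ∷_) (glaisher-injective (Linked-tail k∷κ>) (Linked-tail k′∷κ′>) (All.tail 0<κ) (All.tail 0<κ′)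
                                      (++-cancelˡ-↭ (replicate (2 ^ exponent k) (oddPart k)) g↭g′))

-- The encoding

parityTail : ℕ → ℕ → List ℕ
parityTail p q = replicate p 2 ++ replicate q 1

parityTail-strict : ∀ {p q} → p ≤ 1 → q ≤ 1 → Linked _>_ (parityTail p q)
parityTail-strict {0} {0} _ _ = []
parityTail-strict {0} {1} _ _ = [-]
parityTail-strict {1} {0} _ _ = [-]
parityTail-strict {1} {1} _ _ = s≤s (s≤s z≤n) ∷ [-]
parityTail-strict {suc (suc _)} (s≤s ()) _
parityTail-strict {_} {suc (suc _)} _ (s≤s ())

parityTail-bounds : ∀ p q → All (λ t → 0 < t × t < 3) (parityTail p q)
parityTail-bounds p q = Allₚ.++⁺ (Allₚ.replicate⁺ p (s≤s z≤n , ≤-refl)) (Allₚ.replicate⁺ q (s≤s z≤n , s≤s (s≤s z≤n)))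

sum-parityTail : ∀ p q → sum (parityTail p q) ≡ 2 * p + q
sum-parityTail p q = begin
  sum (replicate p 2 ++ replicate q 1)
    ≡⟨ sum-++ (replicate p 2) (replicate q 1) ⟩
  sum (replicate p 2) + sum (replicate q 1)
    ≡⟨ cong₂ _+_ (trans (sum-replicate p 2) (*-comm p 2)) (trans (sum-replicate q 1) (*-identityʳ q)) ⟩
  2 * p + q
    ∎
  where open ≡-Reasoning

parityTail-injective : ∀ {p q p′ q′} → parityTail p q ≡ parityTail p′ q′ → p ≡ p′ × q ≡ q′
parityTail-injective {p} {q} {p′} {q′} eq =
  trans (sym (count2 p q)) (trans (cong (count 2) eq) (count2 p′ q′)) ,
  trans (sym (count1 p q)) (trans (cong (count 1) eq) (count1 p′ q′))
  where
  count2 : ∀ p q → count 2 (parityTail p q) ≡ p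
  count2 p q = trans (count-++ 2 (replicate p 2) (replicate q 1))
                     (trans (cong₂ _+_ (count-replicate 2 p 2) (count-replicate 2 q 1)) (trans (+-identityʳ (1 * p)) (*-identityˡ p)))
  count1 : ∀ p q → count 1 (parityTail p q) ≡ q
  count1 p q = trans (count-++ 1 (replicate p 2) (replicate q 1))
                     (trans (cong₂ _+_ (count-replicate 1 p 2) (count-replicate 1 q 1)) (*-identityˡ q))

remainder : List ℕ → ℕ → ℕ → List ℕ
remainder λs g₁ g₂ = remove g₂ (remove g₁ (removeStaircase λs))

smallCode : ℕ → ℕ
smallCode y = 3 + 2 * (y / 2)

largeCode : ℕ → ℕ → ℕ
largeCode x y = smallCode y + 2 * (x / 2)

core : List ℕ → ℕ → ℕ → List ℕ
core λs g₁ g₂ = map (2 +_) (addStaircase (remainder λs g₁ g₂)) ++ parityTail ((g₂ ∸ 1) % 2) ((g₁ ∸ g₂ ∸ 1) % 2)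

encode : List ℕ × ℕ × ℕ → List ℕ × ℕ × ℕ
encode (λs , g₁ , g₂) = sortDesc (b ∷ a ∷ glaisher (core λs g₁ g₂)) , b , a
  where
  a b : ℕ
  a = smallCode (g₂ ∸ 1)
  b = largeCode (g₁ ∸ g₂ ∸ 1) (g₂ ∸ 1)

record Admissible (λs : List ℕ) (g₁ g₂ : ℕ) : Set where
  field
    strict   : Linked _>_ λs
    positive : All (0 <_) λs
    g₂<g₁    : g₂ < g₁
    0<g₂     : 0 < g₂
    g₁∈      : g₁ ∈ removeStaircase λs
    g₂∈      : g₂ ∈ removeStaircase λs

weight-identity : ∀ x y t s ℓ →
  largeCode x y + (smallCode y + (t + s + 2 * ℓ + (2 * (y % 2) + x % 2)))
  ≡ (2 + ℓ + (1 + ℓ + t)) + ((2 + x + y) + ((1 + y) + s))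
weight-identity x y t s ℓ = begin
  largeCode x y + (smallCode y + (t + s + 2 * ℓ + (2 * (y % 2) + x % 2)))
    ≡⟨ solve 7 (λ px hx py hy t s ℓ →
         con 3 :+ con 2 :* hy :+ con 2 :* hx :+ (con 3 :+ con 2 :* hy :+ (t :+ s :+ con 2 :* ℓ :+ (con 2 :* py :+ px)))
         := con 2 :+ ℓ :+ (con 1 :+ ℓ :+ t)
            :+ ((con 2 :+ (px :+ hx :* con 2) :+ (py :+ hy :* con 2)) :+ ((con 1 :+ (py :+ hy :* con 2)) :+ s)))
         refl (x % 2) (x / 2) (y % 2) (y / 2) t s ℓ ⟩
  (2 + ℓ + (1 + ℓ + t)) + ((2 + (x % 2 + x / 2 * 2) + (y % 2 + y / 2 * 2)) + ((1 + (y % 2 + y / 2 * 2)) + s))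
    ≡⟨ cong₂ (λ x y → (2 + ℓ + (1 + ℓ + t)) + ((2 + x + y) + ((1 + y) + s))) (m≡m%n+[m/n]*n x 2) (m≡m%n+[m/n]*n y 2) ⟨
  (2 + ℓ + (1 + ℓ + t)) + ((2 + x + y) + ((1 + y) + s))
    ∎
  where open ≡-Reasoning

module Encoded {λs g₁ g₂} (adm : Admissible λs g₁ g₂) where
  open Admissible adm

  w r ν : List ℕ
  w = removeStaircase λs
  r = remainder λs g₁ g₂
  ν = map (2 +_) (addStaircase r)

  x y a b : ℕ
  x = g₁ ∸ g₂ ∸ 1
  y = g₂ ∸ 1
  a = smallCode y
  b = largeCode x y

  μ : List ℕ
  μ = proj₁ (encode (λs , g₁ , g₂))

  w-sorted : Linked _≥_ w
  w-sorted = removeStaircase-sorted strict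

  w↭ : w ↭ g₁ ∷ g₂ ∷ r
  w↭ = ↭-trans (remove-↭ g₁∈) (↭-prep g₁ (remove-↭ g₂∈w∖g₁))
    where
    g₂∈w∖g₁ : g₂ ∈ remove g₁ w
    g₂∈w∖g₁ with ∈-resp-↭ (remove-↭ g₁∈) g₂∈
    ... | here g₂≡g₁ = ⊥-elim (<⇒≢ g₂<g₁ g₂≡g₁)
    ... | there g₂∈  = g₂∈

  r-sorted : Linked _≥_ r
  r-sorted = remove-sorted (remove-sorted w-sorted)

  g₂≡ : g₂ ≡ 1 + y
  g₂≡ = sym (trans (+-comm 1 y) (m∸n+n≡m 0<g₂))

  g₁≡ : g₁ ≡ 2 + x + y
  g₁≡ = begin
    g₁                 ≡⟨ m∸n+n≡m (<⇒≤ g₂<g₁) ⟨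
    g₁ ∸ g₂ + g₂       ≡⟨ cong₂ _+_ (sym (trans (+-comm 1 x) (m∸n+n≡m (m<n⇒0<n∸m g₂<g₁)))) g₂≡ ⟩
    1 + x + (1 + y)    ≡⟨ solve 2 (λ x y → con 1 :+ x :+ (con 1 :+ y) := con 2 :+ x :+ y) refl x y ⟩
    2 + x + y          ∎
    where open ≡-Reasoning

  ν-strict : Linked _>_ ν
  ν-strict = Linkedₚ.map⁺ (Linked.map (λ lt → s≤s (s≤s lt)) (addStaircase-strict r-sorted))

  ν≥3 : All (3 ≤_) ν
  ν≥3 = Allₚ.map⁺ (All.map (λ 0<k → s≤s (s≤s 0<k)) (addStaircase-positive r))

  tail<3 : All (_< 3) (parityTail (y % 2) (x % 2))
  tail<3 = All.map proj₂ (parityTail-bounds (y % 2) (x % 2))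

  core-strict : Linked _>_ (core λs g₁ g₂)
  core-strict = Linked->-++ ν-strict ν≥3 (parityTail-strict (%2≤1 y) (%2≤1 x)) (All.map ≤-pred tail<3)

  core-positive : All (0 <_) (core λs g₁ g₂)
  core-positive = Allₚ.++⁺ (All.map (≤-trans (s≤s z≤n)) ν≥3) (All.map proj₁ (parityTail-bounds (y % 2) (x % 2)))

  μ↭ : μ ↭ b ∷ a ∷ glaisher (core λs g₁ g₂)
  μ↭ = sortDesc-↭ (b ∷ a ∷ glaisher (core λs g₁ g₂))

  μ-sorted : Linked _≥_ μ
  μ-sorted = sortDesc-sorted (b ∷ a ∷ glaisher (core λs g₁ g₂))

  μ-odd : AllOdd μ
  μ-odd = All-resp-↭ (↭-sym μ↭) (odd+2* {a} (x / 2) a-odd ∷ a-odd ∷ glaisher-odd core-positive)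
    where
    a-odd : Odd a
    a-odd = odd+2* {3} (y / 2) refl

  weight : sum μ ≡ sum λs
  weight = begin
    sum μ
      ≡⟨ sum-↭ μ↭ ⟩
    b + (a + sum (glaisher (core λs g₁ g₂)))
      ≡⟨ cong (λ s → b + (a + s)) (trans (sum-glaisher core-positive) sum-core) ⟩
    b + (a + (triangle ℓ + sum r + 2 * ℓ + (2 * (y % 2) + x % 2)))
      ≡⟨ weight-identity x y (triangle ℓ) (sum r) ℓ ⟩
    (2 + ℓ + (1 + ℓ + triangle ℓ)) + ((2 + x + y) + ((1 + y) + sum r))
      ≡⟨ cong₂ (λ g₁ g₂ → triangle (2 + ℓ) + (g₁ + (g₂ + sum r))) g₁≡ g₂≡ ⟨
    triangle (2 + ℓ) + sum (g₁ ∷ g₂ ∷ r)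
      ≡⟨ cong₂ (λ ℓ′ s → triangle ℓ′ + s) (trans (sym (length-removeStaircase λs)) (↭-length w↭)) (sum-↭ w↭) ⟨
    triangle (length λs) + sum w
      ≡⟨ sum-removeStaircase strict positive ⟨
    sum λs
      ∎
    where
    open ≡-Reasoning
    ℓ : ℕ
    ℓ = length r
    sum-core : sum (core λs g₁ g₂) ≡ triangle ℓ + sum r + 2 * ℓ + (2 * (y % 2) + x % 2)
    sum-core = begin
      sum (ν ++ parityTail (y % 2) (x % 2))
        ≡⟨ sum-++ ν (parityTail (y % 2) (x % 2)) ⟩
      sum ν + sum (parityTail (y % 2) (x % 2))
        ≡⟨ cong₂ _+_ (sum-map-2+ (addStaircase r)) (sum-parityTail (y % 2) (x % 2)) ⟩
      sum (addStaircase r) + 2 * length (addStaircase r) + (2 * (y % 2) + x % 2)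
        ≡⟨ cong₂ (λ s ℓ′ → s + 2 * ℓ′ + (2 * (y % 2) + x % 2)) (sum-addStaircase r) (length-addStaircase r) ⟩
      triangle ℓ + sum r + 2 * ℓ + (2 * (y % 2) + x % 2)
        ∎

  code∈ : (b , a) ∈ pairsOf (hook2Rows μ)
  code∈ = pair∈pairsOf-hook2Rows (s≤s (s≤s z≤n)) (m≤m+n a (2 * (x / 2))) (↭-sym μ↭) μ-sorted μ-odd

  μ-partition : IsPartitionOf (sum λs) μ
  μ-partition = All.map odd⇒positive μ-odd , μ-sorted , weight

encode-injective : ∀ {λs g₁ g₂ λs′ g₁′ g₂′} → Admissible λs g₁ g₂ → Admissible λs′ g₁′ g₂′ →
                   encode (λs , g₁ , g₂) ≡ encode (λs′ , g₁′ , g₂′) → (λs , g₁ , g₂) ≡ (λs′ , g₁′ , g₂′)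
encode-injective {λs} {g₁} {g₂} {λs′} {g₁′} {g₂′} adm adm′ codes≡ =
  cong₂ _,_ λs≡ (cong₂ _,_ g₁≡g₁′ g₂≡g₂′)
  where
  module E  = Encoded adm
  module E′ = Encoded adm′
  a≡ : E.a ≡ E′.a
  a≡ = cong (proj₂ ∘ proj₂) codes≡
  b≡ : E.b ≡ E′.b
  b≡ = cong (proj₁ ∘ proj₂) codes≡
  y/2≡ : E.y / 2 ≡ E′.y / 2
  y/2≡ = *-cancelˡ-≡ _ _ 2 (+-cancelˡ-≡ 3 _ _ a≡)
  x/2≡ : E.x / 2 ≡ E′.x / 2
  x/2≡ = *-cancelˡ-≡ _ _ 2 (+-cancelˡ-≡ E.a _ _ (trans b≡ (cong (_+ 2 * (E′.x / 2)) (sym a≡))))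
  glaisher↭ : glaisher (core λs g₁ g₂) ↭ glaisher (core λs′ g₁′ g₂′)
  glaisher↭ = drop-∷ (drop-∷ (↭-trans (↭-sym E.μ↭) (↭-trans (↭-reflexive (cong proj₁ codes≡))
                (subst₂ (λ b a → E′.μ ↭ b ∷ a ∷ glaisher (core λs′ g₁′ g₂′)) (sym b≡) (sym a≡) E′.μ↭))))
  core≡ : core λs g₁ g₂ ≡ core λs′ g₁′ g₂′
  core≡ = glaisher-injective E.core-strict E′.core-strict E.core-positive E′.core-positive glaisher↭
  ν≡ : E.ν ≡ E′.ν
  ν≡ = proj₁ (++-split E.ν≥3 E′.ν≥3 E.tail<3 E′.tail<3 core≡)
  parities : E.y % 2 ≡ E′.y % 2 × E.x % 2 ≡ E′.x % 2
  parities = parityTail-injective (proj₂ (++-split E.ν≥3 E′.ν≥3 E.tail<3 E′.tail<3 core≡))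
  y≡ : E.y ≡ E′.y
  y≡ = %2-/2-injective (proj₁ parities) y/2≡
  x≡ : E.x ≡ E′.x
  x≡ = %2-/2-injective (proj₂ parities) x/2≡
  g₂≡g₂′ : g₂ ≡ g₂′
  g₂≡g₂′ = trans E.g₂≡ (trans (cong suc y≡) (sym E′.g₂≡))
  g₁≡g₁′ : g₁ ≡ g₁′
  g₁≡g₁′ = trans E.g₁≡ (trans (cong₂ (λ x y → 2 + x + y) x≡ y≡) (sym E′.g₁≡))
  r≡ : E.r ≡ E′.r
  r≡ = begin
    E.r                                      ≡⟨ removeStaircase-addStaircase E.r ⟨
    removeStaircase (addStaircase E.r)       ≡⟨ cong removeStaircase (map-injective (+-cancelˡ-≡ 2 _ _) ν≡) ⟩
    removeStaircase (addStaircase E′.r)      ≡⟨ removeStaircase-addStaircase E′.r ⟩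
    E′.r                                     ∎
    where open ≡-Reasoning
  w≡ : E.w ≡ E′.w
  w≡ = sorted-↭⇒≡ E.w-sorted E′.w-sorted
         (↭-trans E.w↭ (subst (_↭ E′.w) (sym (cong₂ _∷_ g₁≡g₁′ (cong₂ _∷_ g₂≡g₂′ r≡))) (↭-sym E′.w↭)))
  λs≡ : λs ≡ λs′
  λs≡ = begin
    λs                                       ≡⟨ addStaircase-removeStaircase (Admissible.strict adm) (Admissible.positive adm) ⟨
    addStaircase E.w                         ≡⟨ cong addStaircase w≡ ⟩
    addStaircase E′.w                        ≡⟨ addStaircase-removeStaircase (Admissible.strict adm′) (Admissible.positive adm′) ⟩
    λs′                                      ∎
    where open ≡-Reasoning

-- Counting both sides

distinctHookPairs : List ℕ → List (ℕ × ℕ)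
distinctHookPairs λs = pairsOf (distinctParts (removeStaircase λs))

oddHookPairs : List ℕ → List (ℕ × ℕ)
oddHookPairs μ = pairsOf (hook2Rows μ)

distinctTriples : ℕ → List (List ℕ × ℕ × ℕ)
distinctTriples n = tagged distinctHookPairs (filter distinct? (partitions n))

oddTriples : ℕ → List (List ℕ × ℕ × ℕ)
oddTriples n = tagged oddHookPairs (filter allOdd? (partitions n))

∈-distinctPartitions⁻ : ∀ {n λs} → λs ∈ filter distinct? (partitions n) → Linked _>_ λs × All (0 <_) λs × sum λs ≡ n
∈-distinctPartitions⁻ {n} λs∈ with ∈-filter⁻ distinct? {xs = partitions n} λs∈
... | λs∈partitions , λs! with ∈-partitions⁻ λs∈partitions
...   | 0<λs , λs≥ , sum≡n = Linked-≥∧Unique⇒Linked-> λs≥ λs! , 0<λs , sum≡n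

∈-distinctTriples⇒Admissible : ∀ {n λs g₁ g₂} → (λs , g₁ , g₂) ∈ distinctTriples n →
                               Admissible λs g₁ g₂ × sum λs ≡ n
∈-distinctTriples⇒Admissible {n} {λs} {g₁} {g₂} code∈
  with λs∈ , pair∈ ← ∈-tagged⁻ distinctHookPairs (filter distinct? (partitions n)) code∈
  with λs> , 0<λs , sum≡n ← ∈-distinctPartitions⁻ {n} λs∈
  with g₁∈ , g₂∈ ← ∈-pairsOf⁻ {xs = distinctParts (removeStaircase λs)} pair∈ = adm , sum≡n
  where
  adm : Admissible λs g₁ g₂
  adm = record
    { strict   = λs>
    ; positive = 0<λs
    ; g₂<g₁    = All.lookup (AllPairs⇒All-pairsOf (distinctParts-strict (removeStaircase-sorted λs>))) pair∈
    ; 0<g₂     = All.lookup (distinctParts-positive (removeStaircase λs)) g₂∈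
    ; g₁∈      = distinctParts-⊆ g₁∈
    ; g₂∈      = distinctParts-⊆ g₂∈
    }

length-distinctTriples≤length-oddTriples : ∀ n → length (distinctTriples n) ≤ length (oddTriples n)
length-distinctTriples≤length-oddTriples n = begin
  length (distinctTriples n)
    ≡⟨ length-map encode (distinctTriples n) ⟨
  length (map encode (distinctTriples n))
    ≤⟨ Unique-⊆⇒length-≤ (Unique-map-injectiveOn encode encode-injectiveOn distinctTriples!) encode-into ⟩
  length (oddTriples n)
    ∎
  where
  open ≤-Reasoning
  distinctTriples! : Unique (distinctTriples n)
  distinctTriples! = Unique-tagged distinctHookPairs (Uniqueₚ.filter⁺ distinct? (Unique-partitions n)) λ λs∈ →
    Unique-pairsOf (AllPairs->⇒Unique (distinctParts-strict (removeStaircase-sorted (proj₁ (∈-distinctPartitions⁻ {n} λs∈)))))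
  encode-injectiveOn : ∀ {c c′} → c ∈ distinctTriples n → c′ ∈ distinctTriples n → encode c ≡ encode c′ → c ≡ c′
  encode-injectiveOn c∈ c′∈ =
    encode-injective (proj₁ (∈-distinctTriples⇒Admissible {n} c∈)) (proj₁ (∈-distinctTriples⇒Admissible {n} c′∈))
  encode-into : map encode (distinctTriples n) ⊆ oddTriples n
  encode-into c∈ with ∈-map⁻ encode c∈
  ... | (λs , g₁ , g₂) , code∈ , refl with ∈-distinctTriples⇒Admissible {n} code∈
  ...   | adm , refl = ∈-tagged⁺ oddHookPairs (∈-filter⁺ allOdd? (∈-partitions⁺ μ-partition) μ-odd) code∈′
    where open Encoded adm renaming (code∈ to code∈′)

hooks2<1+n : ∀ {n λs} → λs ∈ partitions n → hooks2 λs < suc n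
hooks2<1+n {n} {λs} λs∈ with ∈-partitions⁻ {n} λs∈
... | 0<λs , λs≥ , refl = s≤s (≤-trans (hooks2≤length λs≥) (length≤sum 0<λs))

weightedSum≡sum-C2 : ∀ {q} {Q : Pred (List ℕ) q} (Q? : Decidable Q) n →
                     sum (map (λ m → (m C 2) * length (filter (λ λs → Q? λs ×-dec (hooks2 λs ≟ m)) (partitions n))) (upTo (suc n)))
                     ≡ sum (map (λ λs → hooks2 λs C 2) (filter Q? (partitions n)))
weightedSum≡sum-C2 Q? n = sum-fibres Q? hooks2 (_C 2) (suc n) (partitions n) (All.tabulate hooks2<1+n)

sum-C2-distinct : ∀ n → sum (map (λ λs → hooks2 λs C 2) (filter distinct? (partitions n))) ≡ length (distinctTriples n)
sum-C2-distinct n =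
  trans (sum-map-cong _ _ (filter distinct? (partitions n)) C2≡) (sym (length-tagged distinctHookPairs (filter distinct? (partitions n))))
  where
  C2≡ : ∀ {λs} → λs ∈ filter distinct? (partitions n) → hooks2 λs C 2 ≡ length (distinctHookPairs λs)
  C2≡ {λs} λs∈ with ∈-distinctPartitions⁻ {n} λs∈
  ... | λs> , 0<λs , _ = trans (cong (_C 2) (hooks2-distinct λs> 0<λs)) (sym (length-pairsOf (distinctParts (removeStaircase λs))))

sum-C2-odd : ∀ n → sum (map (λ μ → hooks2 μ C 2) (filter allOdd? (partitions n))) ≡ length (oddTriples n)
sum-C2-odd n =
  trans (sum-map-cong _ _ (filter allOdd? (partitions n)) C2≡) (sym (length-tagged oddHookPairs (filter allOdd? (partitions n))))
  where
  C2≡ : ∀ {μ} → μ ∈ filter allOdd? (partitions n) → hooks2 μ C 2 ≡ length (oddHookPairs μ)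
  C2≡ {μ} μ∈ with ∈-partitions⁻ {n} (proj₁ (∈-filter⁻ allOdd? {xs = partitions n} μ∈))
  ... | _ , μ≥ , _ = trans (cong (_C 2) (sym (length-hook2Rows μ≥))) (sym (length-pairsOf (hook2Rows μ)))

theorem2p9 : (n : ℕ) → weightedSum a₂ n ≥ weightedSum b₂ n
theorem2p9 n = begin
  weightedSum b₂ n                                                   ≡⟨ weightedSum≡sum-C2 distinct? n ⟩
  sum (map (λ λs → hooks2 λs C 2) (filter distinct? (partitions n))) ≡⟨ sum-C2-distinct n ⟩
  length (distinctTriples n)                                         ≤⟨ length-distinctTriples≤length-oddTriples n ⟩
  length (oddTriples n)                                              ≡⟨ sum-C2-odd n ⟨
  sum (map (λ μ → hooks2 μ C 2) (filter allOdd? (partitions n)))     ≡⟨ weightedSum≡sum-C2 allOdd? n ⟨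
  weightedSum a₂ n                                                   ∎
  where open ≤-Reasoning
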